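{- Let $n\ge 2$ be an integer. Let $G$ be a graph on $n^2+n$ vertices such that $V(G)=X_1\cup \cdots \cup X_n\cup Q$ for disjoint sets $X_1,\ldots, X_n,Q$ of $n$ vertices each, each $X_i$ is a clique in $G$, $G[X_1\cup \cdots \cup X_n]$ is isomorphic to $nK_n$, and all $G[X_i\cup Q]$ are isomorphic to $K_n\oplus_{\neq} \overline{K_n}$. Then $G$ has a vertex-minor isomorphic to $P_{4n-5}$.
   Context: $\overline{K_n}$ is the edgeless graph on $n$ vertices, $nK_n$ the disjoint union of $n$ copies of $K_n$, $P_m$ the path on $m$ vertices. For two $n$-vertex graphs $G,H$ on disjoint vertex sets with orderings $v_1,\dots,v_n$ and $w_1,\dots,w_n$, $G\oplus_{\neq}H$ is the graph on $V(G)\cup V(H)$ inducing $G$ on $V(G)$ and $H$ on $V(H)$, in which $v_iw_j$ is an edge iff $i\neq j$ (i.e. the complement of a perfect matching is added between them). Local complementation at $v$ replaces the subgraph induced on $N_G(v)$ by its complement; a vertex-minor of $G$ is an induced subgraph of a graph obtained from $G$ by a sequence of local complementations. -}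

module Defs where

open import Data.Bool using (Bool; true; false; _∧_; _∨_; _xor_; not)
open import Data.Nat using (ℕ; suc; _≡ᵇ_)
open import Data.Fin using (Fin; toℕ; splitAt; quotient; _≟_)
open import Data.Sum using (_⊎_; inj₁; inj₂)
open import Data.Product using (Σ; Σ-syntax; _×_; _,_)
open import Relation.Nullary.Decidable using (⌊_⌋)
open import Relation.Binary.PropositionalEquality using (_≡_)
open import Function.Bundles using (_↔_; Inverse)
open import Function.Definitions using (Injective)

Adj : ℕ → Set
Adj m = Fin m → Fin m → Bool

IsSimple : ∀ {m} → Adj m → Set
IsSimple {m} A = (∀ (u v : Fin m) → A u v ≡ A v u) × (∀ (v : Fin m) → A v v ≡ false)

_==_ : ∀ {m} → Fin m → Fin m → Bool
x == y = ⌊ x ≟ y ⌋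

localComp : ∀ {m} → Adj m → Fin m → Adj m
localComp A v x y = A x y xor (A v x ∧ A v y ∧ not (x == y))

data LCSeq {m} (A : Adj m) : Adj m → Set where
  lc-refl : LCSeq A A
  lc-step : ∀ {B} → LCSeq A B → (v : Fin m) → LCSeq A (localComp B v)

induced : ∀ {k m} → Adj m → (Fin k → Fin m) → Adj k
induced A ι x y = A (ι x) (ι y)

Iso : ∀ {k} → Adj k → Adj k → Set
Iso {k} A B = Σ[ f ∈ Fin k ↔ Fin k ] (∀ x y → A x y ≡ B (Inverse.to f x) (Inverse.to f y))

IsVertexMinor : ∀ {k m} → Adj k → Adj m → Set
IsVertexMinor {k} {m} H G =
  Σ[ B ∈ Adj m ] (LCSeq G B ×
    Σ[ ι ∈ (Fin k → Fin m) ] (Injective _≡_ _≡_ ι × Iso (induced B ι) H))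

path : (k : ℕ) → Adj k
path k x y = (toℕ x ≡ᵇ suc (toℕ y)) ∨ (toℕ y ≡ᵇ suc (toℕ x))

-- n K_n on Fin (n * n): vertex z lies in copy 'quotient n z'
nKn : (n : ℕ) → Adj (n Data.Nat.* n)
nKn n x y = ⌊ quotient {n} n x ≟ quotient {n} n y ⌋ ∧ not (x == y)

-- K_n ⊕≠ \overline{K_n} on Fin (n + n): first n vertices form K_n,
-- last n vertices are independent, v_i w_j adjacent iff i ≠ j.
KnPlusNeqCoKn : (n : ℕ) → Adj (n Data.Nat.+ n)
KnPlusNeqCoKn n x y with splitAt n x | splitAt n y
... | inj₁ a | inj₁ b = not (a == b)
... | inj₁ a | inj₂ b = not (a == b)
... | inj₂ a | inj₁ b = not (a == b)
... | inj₂ a | inj₂ b = false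

enumXs : ∀ {n m} → (Fin n → Fin n → Fin m) → Fin (n Data.Nat.* n) → Fin m
enumXs {n} X z = X (quotient {n} n z) (Data.Fin.remainder {n} n z)

enumXQ : ∀ {n m} → (Fin n → Fin n → Fin m) → (Fin n → Fin m) → Fin n → Fin (n Data.Nat.+ n) → Fin m
enumXQ {n} X Q i z with splitAt n z
... | inj₁ a = X i a
... | inj₂ b = Q b

enumAll : ∀ {n m} → (Fin n → Fin n → Fin m) → (Fin n → Fin m) → ((Fin n × Fin n) ⊎ Fin n) → Fin m
enumAll X Q (inj₁ (i , a)) = X i a
enumAll X Q (inj₂ b) = Q b

module Submission where

-- The image of the clique Xᵢ in Kₙ ⊕≠ co-Kₙ is
-- either the Kₙ side ("type A") or the Kₙ side with one vertex vⱼ replaced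
-- by wⱼ ("type B").  Since G[Q] is the same for every i, all blocks have the
-- same type, and when n ≥ 3 the type-B star in G[Q] has a unique centre.
-- Hence the vertices can be named x_{i,k} (block i) and q_l so that G is one
-- of two explicit "models" (typeA, typeB) on the coordinate set Coord n.
-- (2) Local complementation is computed on models: along a coordinate
-- embedding, G agrees with a model, and this agreement is preserved by
-- local complementations (Agreement).  Explicit sequences of local
-- complementations turn both models into the comb model: each block
-- 1,…,n-1 is a star centred at x_{i,0}, and x_{i,k} is matched to q_k.
-- (3) The comb contains the induced path
--   x₁₁ x₁₀ x₁₂ q₂ x₂₂ x₂₀ x₂₃ q₃ … x_{n-1,n-1} x_{n-1,0} x_{n-1,1},
-- of 4(n-1)-1 vertices, checked gadget by gadget with natural-number
-- coordinates.  For n = 2 an induced P₃ is read off directly.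

open import Defs
open import Data.Nat as ℕ using (ℕ; zero; suc; _≤_; _<_; _+_; _*_; _∸_; z≤n; s≤s; _≡ᵇ_)
open import Data.Fin as F using (Fin; zero; suc; toℕ; _↑ˡ_; _↑ʳ_; splitAt; combine; quotient; remainder; punchOut)
import Data.Fin.Properties as FP
import Data.Nat.Properties as NP
import Data.Nat.DivMod as DM
import Data.Fin.Permutation.Components as PC
open import Data.Bool using (Bool; true; false; _∧_; _∨_; _xor_; not; if_then_else_)
open import Data.Bool.Properties using (∧-zeroʳ; ∧-identityʳ; ∨-identityʳ; ∨-zeroʳ; xor-identityʳ; xor-assoc; xor-comm)
open import Data.Sum using (inj₁; inj₂; [_,_]′)
open import Data.Product using (Σ; _×_; _,_; proj₁; proj₂)
open import Data.Empty using (⊥; ⊥-elim)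
open import Data.List using (List; []; _∷_; map; _++_)
open import Relation.Nullary using (¬_; yes; no; Dec)
open import Relation.Binary.Definitions using (tri<; tri≈; tri>)
open import Relation.Binary.PropositionalEquality using (_≡_; _≢_; refl; sym; trans; cong; cong₂; subst; module ≡-Reasoning)
open import Function.Bundles using (_↔_; Inverse; mk↔ₛ′)
open import Function.Definitions using (Injective; Bijective)

true≢false : true ≢ false
true≢false ()

-- Boolean equality on Fin that reduces on constructors.  (Defs' _==_ is
-- defined through a Dec and does not compute on open terms.)

eqF : ∀ {n} → Fin n → Fin n → Bool
eqF zero    zero    = true
eqF zero    (suc _) = false
eqF (suc _) zero    = false
eqF (suc a) (suc b) = eqF a b

eqF-refl : ∀ {n} (a : Fin n) → eqF a a ≡ true
eqF-refl zero    = refl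
eqF-refl (suc a) = eqF-refl a

eqF-true : ∀ {n} {a b : Fin n} → eqF a b ≡ true → a ≡ b
eqF-true {a = zero}  {zero}  _ = refl
eqF-true {a = suc a} {suc b} p = cong suc (eqF-true p)

eqF-false : ∀ {n} {a b : Fin n} → a ≢ b → eqF a b ≡ false
eqF-false {a = zero}  {zero}  a≢b = ⊥-elim (a≢b refl)
eqF-false {a = zero}  {suc b} _   = refl
eqF-false {a = suc a} {zero}  _   = refl
eqF-false {a = suc a} {suc b} a≢b = eqF-false (λ e → a≢b (cong suc e))

eqF-sym : ∀ {n} (a b : Fin n) → eqF a b ≡ eqF b a
eqF-sym zero    zero    = refl
eqF-sym zero    (suc b) = refl
eqF-sym (suc a) zero    = refl
eqF-sym (suc a) (suc b) = eqF-sym a b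

eqF-toℕ : ∀ {n} (a b : Fin n) → eqF a b ≡ (toℕ a ≡ᵇ toℕ b)
eqF-toℕ zero    zero    = refl
eqF-toℕ zero    (suc b) = refl
eqF-toℕ (suc a) zero    = refl
eqF-toℕ (suc a) (suc b) = eqF-toℕ a b

==-eqF : ∀ {n} (a b : Fin n) → (a == b) ≡ eqF a b
==-eqF a b with a F.≟ b
... | yes refl = sym (eqF-refl a)
... | no a≢b   = sym (eqF-false a≢b)

==-iff : ∀ {N} (x y : Fin N) (b : Bool) → (x ≡ y → b ≡ true) → (b ≡ true → x ≡ y) → (x == y) ≡ b
==-iff x y b to from with x F.≟ y
... | yes x≡y = sym (to x≡y)
==-iff x y true  to from | no x≢y = ⊥-elim (x≢y (from refl))
==-iff x y false to from | no x≢y = refl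

eqF-injective : ∀ {n m} {f : Fin n → Fin m} → Injective _≡_ _≡_ f → ∀ a b → eqF (f a) (f b) ≡ eqF a b
eqF-injective {f = f} inj a b with a F.≟ b
... | yes refl = trans (eqF-refl (f a)) (sym (eqF-refl a))
... | no a≢b   = trans (eqF-false (λ e → a≢b (inj e))) (sym (eqF-false a≢b))

inj⇒surj : ∀ {n} (f : Fin n → Fin n) → Injective _≡_ _≡_ f → ∀ b → Σ (Fin n) (λ a → f a ≡ b)
inj⇒surj {suc n} f inj b with FP.any? (λ a → f a F.≟ b)
... | yes hit = hit
... | no miss = ⊥-elim (FP.<⇒notInjective (NP.n<1+n n) g-inj)
  where
  g : Fin (suc n) → Fin n
  g a = punchOut {i = b} (λ e → miss (a , sym e))
  g-inj : Injective _≡_ _≡_ g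
  g-inj {a} {a'} e = inj (FP.punchOut-injective (λ e' → miss (a , sym e')) (λ e' → miss (a' , sym e')) e)

-- The transposition of 0 and c, used to rename a vertex q_c as q_0.
swap₀ : ∀ {n} → Fin (suc n) → Fin (suc n) → Fin (suc n)
swap₀ c = PC.transpose zero c

swap₀-inj : ∀ {n} (c : Fin (suc n)) → Injective _≡_ _≡_ (swap₀ c)
swap₀-inj c p = trans (sym (PC.transpose-inverse c zero)) (trans (cong (PC.transpose c zero) p) (PC.transpose-inverse c zero))

applyLCs : ∀ {m} → Adj m → List (Fin m) → Adj m
applyLCs A []       = A
applyLCs A (v ∷ vs) = applyLCs (localComp A v) vs

lcseq-applyLCs : ∀ {m} {A B : Adj m} → LCSeq A B → (L : List (Fin m)) → LCSeq A (applyLCs B L)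
lcseq-applyLCs s []       = s
lcseq-applyLCs s (v ∷ vs) = lcseq-applyLCs (lc-step s v) vs

lc-loopless : ∀ {m} (A : Adj m) → (∀ v → A v v ≡ false) → ∀ w v → localComp A w v v ≡ false
lc-loopless A loopless w v rewrite loopless v | ==-eqF v v | eqF-refl v with A w v
... | true  = refl
... | false = refl

lcseq-loopless : ∀ {m} {A B : Adj m} → LCSeq A B → (∀ v → A v v ≡ false) → ∀ v → B v v ≡ false
lcseq-loopless lc-refl          loopless = loopless
lcseq-loopless (lc-step {B} s w) loopless = lc-loopless B (lcseq-loopless s loopless) w

-- Coordinates and models.  'Coord n' names the n² + n vertices as
-- x_{i,k} (block i, position k) and q_l; a 'Model' is a graph on
-- coordinates, on which local complementation is computed symbolically.

data Coord (n : ℕ) : Set where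
  xv : Fin n → Fin n → Coord n
  qv : Fin n → Coord n

eqC : ∀ {n} → Coord n → Coord n → Bool
eqC (xv i k) (xv j k') = eqF i j ∧ eqF k k'
eqC (xv _ _) (qv _)    = false
eqC (qv _)   (xv _ _)  = false
eqC (qv l)   (qv l')   = eqF l l'

Model : ℕ → Set
Model n = Coord n → Coord n → Bool

lcModel : ∀ {n} → Model n → Coord n → Model n
lcModel F w u v = F u v xor (F w u ∧ F w v ∧ not (eqC u v))

-- Along an injective coordinate embedding e, a graph B "agrees with" a model
-- F on the coordinates satisfying P.  Local complementation at a vertex of P
-- preserves agreement (agrees-lc), which reduces every computation of a
-- local complementation sequence to a computation on models.
module Agreement {n N : ℕ} (e : Coord n → Fin N) (e-eq : ∀ u v → (e u == e v) ≡ eqC u v) where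

  record Agrees (P : Coord n → Bool) (B : Adj N) (F : Model n) : Set where
    constructor agrees
    field on : ∀ u v → P u ≡ true → P v ≡ true → B (e u) (e v) ≡ F u v
  open Agrees public

  agrees-lc : ∀ {P B F} w → P w ≡ true → Agrees P B F → Agrees P (localComp B (e w)) (lcModel F w)
  agrees-lc {P} {B} {F} w Pw (agrees ag) = agrees lc-agrees
    where
    lc-agrees : ∀ u v → P u ≡ true → P v ≡ true → localComp B (e w) (e u) (e v) ≡ lcModel F w u v
    lc-agrees u v Pu Pv rewrite ag u v Pu Pv | ag w u Pw Pu | ag w v Pw Pv | e-eq u v = refl

  agrees-cong : ∀ {P B F F'} → (∀ u v → P u ≡ true → P v ≡ true → F u v ≡ F' u v) → Agrees P B F → Agrees P B F'
  agrees-cong F≗F' (agrees ag) = agrees λ u v Pu Pv → trans (ag u v Pu Pv) (F≗F' u v Pu Pv)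

  agrees-restrict : ∀ {P P' B F} → (∀ u → P' u ≡ true → P u ≡ true) → Agrees P B F → Agrees P' B F
  agrees-restrict P'⊆P (agrees ag) = agrees λ u v P'u P'v → ag u v (P'⊆P u P'u) (P'⊆P v P'v)

xxBlocks : ∀ {n} → Fin n → Fin n → Fin n → Fin n → Bool
xxBlocks i k j k' = eqF i j ∧ not (eqF k k')

typeA : ∀ {n} → Model n
typeA (xv i k) (xv j k') = xxBlocks i k j k'
typeA (xv i k) (qv l)    = not (eqF k l)
typeA (qv l)   (xv i k)  = not (eqF k l)
typeA (qv l)   (qv l')   = false

typeB : ∀ {n₁} → Model (suc n₁)
typeB (xv i k) (xv j k') = xxBlocks i k j k'
typeB (xv i k) (qv l)    = not (eqF k zero) ∧ not (eqF k l)
typeB (qv l)   (xv i k)  = not (eqF k zero) ∧ not (eqF k l)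
typeB (qv l)   (qv l')   = not (eqF l l') ∧ (eqF l zero ∨ eqF l' zero)

normalModel : ∀ {n₁} → Bool → Model (suc n₁)
normalModel false = typeA
normalModel true  = typeB

record NormalForm (n₁ : ℕ) (G : Adj (suc n₁ * suc n₁ + suc n₁)) : Set where
  field
    isTypeB : Bool
    e       : Coord (suc n₁) → Fin (suc n₁ * suc n₁ + suc n₁)
    e-eq    : ∀ u v → (e u == e v) ≡ eqC u v
    agree   : ∀ u v → G (e u) (e v) ≡ normalModel isTypeB u v

-- An induced path a - b - c (used when n = 2).
record InducedP3 {N : ℕ} (G : Adj N) : Set where
  field
    a b c : Fin N
    ab    : G a b ≡ true
    bc    : G b c ≡ true
    ac    : G a c ≡ false
    a≢c   : a ≢ c

module KnNeq (n₁ : ℕ) where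
  n : ℕ
  n = suc n₁

  K : Adj (n + n)
  K = KnPlusNeqCoKn n

  vK : Fin n → Fin (n + n)
  vK a = a ↑ˡ n

  wI : Fin n → Fin (n + n)
  wI b = n ↑ʳ b

  K-vv : ∀ a b → K (vK a) (vK b) ≡ not (a == b)
  K-vv a b rewrite FP.splitAt-↑ˡ n a n | FP.splitAt-↑ˡ n b n = refl

  K-vw : ∀ a b → K (vK a) (wI b) ≡ not (a == b)
  K-vw a b rewrite FP.splitAt-↑ˡ n a n | FP.splitAt-↑ʳ n n b = refl

  K-wv : ∀ a b → K (wI a) (vK b) ≡ not (a == b)
  K-wv a b rewrite FP.splitAt-↑ʳ n n a | FP.splitAt-↑ˡ n b n = refl

  K-ww : ∀ a b → K (wI a) (wI b) ≡ false
  K-ww a b rewrite FP.splitAt-↑ʳ n n a | FP.splitAt-↑ʳ n n b = refl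

  ==-self : ∀ (a : Fin n) → (a == a) ≡ true
  ==-self a = trans (==-eqF a a) (eqF-refl a)

  ==-distinct : ∀ {a b : Fin n} → a ≢ b → (a == b) ≡ false
  ==-distinct {a} {b} a≢b = trans (==-eqF a b) (eqF-false a≢b)

  vK≢wI : ∀ a b → vK a ≢ wI b
  vK≢wI a b e with trans (sym (FP.splitAt-↑ˡ n a n)) (trans (cong (splitAt n) e) (FP.splitAt-↑ʳ n n b))
  ... | ()

  vK-inj : ∀ {a b} → vK a ≡ vK b → a ≡ b
  vK-inj {a} {b} = FP.↑ˡ-injective n a b

  wI-inj : ∀ {a b} → wI a ≡ wI b → a ≡ b
  wI-inj {a} {b} = FP.↑ʳ-injective n a b

  data Side (z : Fin (n + n)) : Set where
    onV : ∀ a → z ≡ vK a → Side z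
    onW : ∀ b → z ≡ wI b → Side z

  side : ∀ z → Side z
  side z with splitAt n z in eq
  ... | inj₁ a = onV a (trans (sym (FP.join-splitAt n n z)) (cong (F.join n n) eq))
  ... | inj₂ b = onW b (trans (sym (FP.join-splitAt n n z)) (cong (F.join n n) eq))

  index : Fin (n + n) → Fin n
  index z = [ (λ a → a) , (λ b → b) ]′ (splitAt n z)

  index-vK : ∀ a → index (vK a) ≡ a
  index-vK a rewrite FP.splitAt-↑ˡ n a n = refl

  index-wI : ∀ b → index (wI b) ≡ b
  index-wI b rewrite FP.splitAt-↑ʳ n n b = refl

  -- Two adjacent vertices with the same index are equal: vₐ ≁ wₐ and the
  -- w-side is independent.
  adjacent-same-index : ∀ z z' → index z ≡ index z' → K z z' ≡ true → z ≡ z'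
  adjacent-same-index z z' same adj with side z | side z'
  ... | onV a refl | onV b refl = cong vK (trans (sym (index-vK a)) (trans same (index-vK b)))
  ... | onV a refl | onW b refl = ⊥-elim (true≢false (absurd-adj (K-vw a b)))
    where
    absurd-adj : K (vK a) (wI b) ≡ not (a == b) → true ≡ false
    absurd-adj Kab rewrite trans (sym (index-vK a)) (trans same (index-wI b)) | ==-self b = trans (sym adj) Kab
  ... | onW a refl | onV b refl = ⊥-elim (true≢false (absurd-adj (K-wv a b)))
    where
    absurd-adj : K (wI a) (vK b) ≡ not (a == b) → true ≡ false
    absurd-adj Kab rewrite trans (sym (index-wI a)) (trans same (index-vK b)) | ==-self b = trans (sym adj) Kab
  ... | onW a refl | onW b refl = ⊥-elim (true≢false (trans (sym adj) (K-ww a b)))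

  enumXQ-vK : ∀ {M} (X : Fin n → Fin n → Fin M) (Q : Fin n → Fin M) i a → enumXQ X Q i (vK a) ≡ X i a
  enumXQ-vK X Q i a rewrite FP.splitAt-↑ˡ n a n = refl

  enumXQ-wI : ∀ {M} (X : Fin n → Fin n → Fin M) (Q : Fin n → Fin M) i b → enumXQ X Q i (wI b) ≡ Q b
  enumXQ-wI X Q i b rewrite FP.splitAt-↑ʳ n n b = refl

  -- One block: the isomorphism g of G[Xᵢ ∪ Q] with K maps the clique Xᵢ
  -- (positions vK a) onto an n-clique of K.  Such a clique is the Kₙ side,
  -- or the Kₙ side with one vⱼ exchanged for wⱼ.
  module CliqueImage (g : Fin (n + n) ↔ Fin (n + n))
                     (clique : ∀ a b → a ≢ b → K (Inverse.to g (vK a)) (Inverse.to g (vK b)) ≡ true) where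
    open Inverse g using (to; from; strictlyInverseˡ; strictlyInverseʳ)

    to-inj : ∀ {z z'} → to z ≡ to z' → z ≡ z'
    to-inj {z} {z'} e = trans (sym (strictlyInverseʳ z)) (trans (cong from e) (strictlyInverseʳ z'))

    -- the index of the image of vK a is injective in a, hence bijective
    pos : Fin n → Fin n
    pos a = index (to (vK a))

    pos-inj : Injective _≡_ _≡_ pos
    pos-inj {a} {a'} same with a F.≟ a'
    ... | yes a≡a' = a≡a'
    ... | no a≢a'  = vK-inj (to-inj (adjacent-same-index _ _ same (clique a a' a≢a')))

    w-in-clique : ∀ l j → to (wI l) ≡ vK j → Σ (Fin n) λ a → to (vK a) ≡ wI j
    w-in-clique l j e with inj⇒surj pos pos-inj j
    ... | a , pos-a with side (to (vK a))
    ... | onV c p = ⊥-elim (vK≢wI a l (to-inj (trans p (trans (cong vK c≡j) (sym e)))))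
      where c≡j : c ≡ j
            c≡j = trans (sym (index-vK c)) (trans (cong index (sym p)) pos-a)
    ... | onW c p = a , trans p (cong wI (trans (sym (index-wI c)) (trans (cong index (sym p)) pos-a)))

    others-independent : ∀ l j → to (wI l) ≡ vK j → ∀ l' → l' ≢ l → Σ (Fin n) λ b → to (wI l') ≡ wI b
    others-independent l j e l' l'≢l with side (to (wI l'))
    ... | onW b p = b , p
    ... | onV c p with inj⇒surj pos pos-inj c | w-in-clique l j e
    ... | a , pos-a | a₀ , to-a₀ with side (to (vK a))
    ... | onV c' p' = ⊥-elim (vK≢wI a l' (to-inj (trans p' (trans (cong vK c'≡c) (sym p)))))
      where c'≡c : c' ≡ c
            c'≡c = trans (sym (index-vK c')) (trans (cong index (sym p')) pos-a)
    ... | onW c' p' with a F.≟ a₀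
    ... | yes refl = ⊥-elim (l'≢l (wI-inj (to-inj (trans p (trans (cong vK c≡j) (sym e))))))
      where c≡j : c ≡ j
            c≡j = trans (sym pos-a) (trans (cong index p') (trans (index-wI c') (wI-inj (trans (sym p') to-a₀))))
    ... | no a≢a₀ = ⊥-elim (true≢false (trans (sym (clique a a₀ a≢a₀)) (trans (cong₂ K p' to-a₀) (K-ww c' j))))

    -- Type A block: Q is sent to the independent side.  Naming x_k the
    -- clique vertex mapped to the partner of q_k's image gives
    -- x_k ~ q_l iff k ≠ l.
    module TypeA (allW : ∀ l → Σ (Fin n) λ b → to (wI l) ≡ wI b) where
      π : Fin n → Fin n
      π l = proj₁ (allW l)

      π-inj : Injective _≡_ _≡_ π
      π-inj {k} {k'} e = wI-inj (to-inj (trans (proj₂ (allW k)) (trans (cong wI e) (sym (proj₂ (allW k'))))))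

      xi : Fin n → Fin n
      xi k = index (from (vK (π k)))

      from-vK : ∀ k → from (vK (π k)) ≡ vK (xi k)
      from-vK k with side (from (vK (π k)))
      ... | onV a p = trans p (cong vK (sym (trans (cong index p) (index-vK a))))
      ... | onW b p = ⊥-elim (vK≢wI _ _ (trans (sym (strictlyInverseˡ (vK (π k)))) (trans (cong to p) (proj₂ (allW b)))))

      to-xi : ∀ k → to (vK (xi k)) ≡ vK (π k)
      to-xi k = trans (cong to (sym (from-vK k))) (strictlyInverseˡ (vK (π k)))

      xi-inj : Injective _≡_ _≡_ xi
      xi-inj {k} {k'} e = π-inj (vK-inj (trans (sym (to-xi k)) (trans (cong (λ a → to (vK a)) e) (to-xi k'))))

      xq-adj : ∀ k l → K (to (vK (xi k))) (to (wI l)) ≡ not (eqF k l)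
      xq-adj k l rewrite to-xi k | proj₂ (allW l) | K-vw (π k) (π l) | ==-eqF (π k) (π l) | eqF-injective π-inj k l = refl

      qq-adj : ∀ l l' → K (to (wI l)) (to (wI l')) ≡ false
      qq-adj l l' = trans (cong₂ K (proj₂ (allW l)) (proj₂ (allW l'))) (K-ww _ _)

    -- With τ a renaming of Q with
    -- τ 0 = centre, x_0 is the clique vertex sent to wⱼ and the others are
    -- named as in type A; then x_k ~ q_l iff k ≠ 0 and k ≠ l.
    module TypeB (centre j : Fin n) (e : to (wI centre) ≡ vK j)
                 (τ : Fin n → Fin n) (τ-inj : Injective _≡_ _≡_ τ) (τ0 : τ zero ≡ centre) where
      a₀ : Fin n
      a₀ = proj₁ (w-in-clique centre j e)

      to-a₀ : to (vK a₀) ≡ wI j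
      to-a₀ = proj₂ (w-in-clique centre j e)

      τ-suc≢centre : ∀ k → τ (suc k) ≢ centre
      τ-suc≢centre k p with τ-inj (trans p (sym τ0))
      ... | ()

      leaf : ∀ k → Σ (Fin n) λ b → to (wI (τ (suc k))) ≡ wI b
      leaf k = others-independent centre j e (τ (suc k)) (τ-suc≢centre k)

      π : Fin n₁ → Fin n
      π k = proj₁ (leaf k)

      π-inj : Injective _≡_ _≡_ π
      π-inj {k} {k'} p = FP.suc-injective (τ-inj (wI-inj (to-inj (trans (proj₂ (leaf k)) (trans (cong wI p) (sym (proj₂ (leaf k'))))))))

      π≢j : ∀ k → π k ≢ j
      π≢j k p = vK≢wI _ _ (to-inj (trans to-a₀ (trans (cong wI (sym p)) (sym (proj₂ (leaf k))))))

      xi-suc : Fin n₁ → Fin n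
      xi-suc k = index (from (vK (π k)))

      from-vK : ∀ k → from (vK (π k)) ≡ vK (xi-suc k)
      from-vK k with side (from (vK (π k)))
      ... | onV a p = trans p (cong vK (sym (trans (cong index p) (index-vK a))))
      ... | onW b p with b F.≟ centre
      ...   | yes refl = ⊥-elim (π≢j k (vK-inj (trans (sym to-wb) e)))
        where to-wb : to (wI b) ≡ vK (π k)
              to-wb = trans (cong to (sym p)) (strictlyInverseˡ _)
      ...   | no b≢centre = ⊥-elim (vK≢wI _ _ (trans (sym to-wb) (proj₂ (others-independent centre j e b b≢centre))))
        where to-wb : to (wI b) ≡ vK (π k)
              to-wb = trans (cong to (sym p)) (strictlyInverseˡ _)

      to-xi-suc : ∀ k → to (vK (xi-suc k)) ≡ vK (π k)
      to-xi-suc k = trans (cong to (sym (from-vK k))) (strictlyInverseˡ _)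

      xi : Fin n → Fin n
      xi zero    = a₀
      xi (suc k) = xi-suc k

      xi-inj : Injective _≡_ _≡_ xi
      xi-inj {zero}  {zero}   p = refl
      xi-inj {zero}  {suc k'} p = ⊥-elim (vK≢wI _ _ (trans (sym (to-xi-suc k')) (trans (cong (λ a → to (vK a)) (sym p)) to-a₀)))
      xi-inj {suc k} {zero}   p = ⊥-elim (vK≢wI _ _ (trans (sym (to-xi-suc k)) (trans (cong (λ a → to (vK a)) p) to-a₀)))
      xi-inj {suc k} {suc k'} p = cong suc (π-inj (vK-inj (trans (sym (to-xi-suc k)) (trans (cong (λ a → to (vK a)) p) (to-xi-suc k')))))

      to-centre : to (wI (τ zero)) ≡ vK j
      to-centre = trans (cong (λ z → to (wI z)) τ0) e

      xq-adj : ∀ k l → K (to (vK (xi k))) (to (wI (τ l))) ≡ not (eqF k zero) ∧ not (eqF k l)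
      xq-adj zero    zero    = trans (cong₂ K to-a₀ to-centre) (trans (K-wv j j) (cong not (==-self j)))
      xq-adj zero    (suc l) = trans (cong₂ K to-a₀ (proj₂ (leaf l))) (K-ww j (π l))
      xq-adj (suc k) zero    = trans (cong₂ K (to-xi-suc k) to-centre) (trans (K-vv (π k) j) (cong not (==-distinct (π≢j k))))
      xq-adj (suc k) (suc l) = trans (cong₂ K (to-xi-suc k) (proj₂ (leaf l)))
                                 (trans (K-vw (π k) (π l)) (cong not (trans (==-eqF (π k) (π l)) (eqF-injective π-inj k l))))

    centre-adj : ∀ l j → to (wI l) ≡ vK j → ∀ l' → l' ≢ l → K (to (wI l)) (to (wI l')) ≡ true
    centre-adj l j e l' l'≢l with others-independent l j e l' l'≢l | w-in-clique l j e
    ... | b , p | a₀ , to-a₀ = trans (cong₂ K e p) (trans (K-vw j b) (cong not (==-distinct j≢b)))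
      where j≢b : j ≢ b
            j≢b q = vK≢wI _ _ (to-inj (trans to-a₀ (trans (cong wI q) (sym p))))

    leaves-nonadj : ∀ l j → to (wI l) ≡ vK j → ∀ l' l'' → l' ≢ l → l'' ≢ l → K (to (wI l')) (to (wI l'')) ≡ false
    leaves-nonadj l j e l' l'' l'≢l l''≢l =
      trans (cong₂ K (proj₂ (others-independent l j e l' l'≢l)) (proj₂ (others-independent l j e l'' l''≢l))) (K-ww _ _)

module Hypotheses (n₁ : ℕ) where
  open KnNeq n₁ public

  N : ℕ
  N = n * n + n

  module Assume (G : Adj N) (simple : IsSimple G)
                (X : Fin n → Fin n → Fin N) (Q : Fin n → Fin N)
                (bij : Bijective _≡_ _≡_ (enumAll X Q))
                (clique : ∀ i a b → a ≢ b → G (X i a) (X i b) ≡ true)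
                (isoX : Iso (induced G (enumXs X)) (nKn n))
                (isoQ : ∀ i → Iso (induced G (enumXQ X Q i)) (KnPlusNeqCoKn n)) where

    G-sym : ∀ u v → G u v ≡ G v u
    G-sym = proj₁ simple

    G-loopless : ∀ v → G v v ≡ false
    G-loopless = proj₂ simple

    X-inj : ∀ {i j a b} → X i a ≡ X j b → (i ≡ j) × (a ≡ b)
    X-inj p with proj₁ bij {inj₁ (_ , _)} {inj₁ (_ , _)} p
    ... | refl = refl , refl

    X≢Q : ∀ {i a l} → X i a ≢ Q l
    X≢Q p with proj₁ bij {inj₁ (_ , _)} {inj₂ _} p
    ... | ()

    Q-inj : ∀ {l l'} → Q l ≡ Q l' → l ≡ l'
    Q-inj p with proj₁ bij {inj₂ _} {inj₂ _} p
    ... | refl = refl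

    φ : Fin (n * n) → Fin (n * n)
    φ = Inverse.to (proj₁ isoX)

    φ-inj : ∀ {z z'} → φ z ≡ φ z' → z ≡ z'
    φ-inj {z} {z'} p = trans (sym (Inverse.strictlyInverseʳ (proj₁ isoX) z))
                         (trans (cong (Inverse.from (proj₁ isoX)) p) (Inverse.strictlyInverseʳ (proj₁ isoX) z'))

    G-XX : ∀ i a j b → G (X i a) (X j b) ≡ nKn n (φ (combine i a)) (φ (combine j b))
    G-XX i a j b = trans (sym (cong₂ G (enumXs-combine i a) (enumXs-combine j b))) (proj₂ isoX (combine i a) (combine j b))
      where
      enumXs-combine : ∀ i a → enumXs X (combine i a) ≡ X i a
      enumXs-combine i a = cong (λ p → X (proj₁ p) (proj₂ p)) (FP.remQuot-combine {n} {n} i a)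

    component : Fin n → Fin n → Fin n
    component i a = quotient {n} n (φ (combine i a))

    adjacent⇒same-component : ∀ i a j b → G (X i a) (X j b) ≡ true → component i a ≡ component j b
    adjacent⇒same-component i a j b adj with component i a F.≟ component j b | trans (sym (G-XX i a j b)) adj
    ... | yes same | _ = same
    ... | no _     | ()

    block-in-one-component : ∀ i a a' → component i a ≡ component i a'
    block-in-one-component i a a' with a F.≟ a'
    ... | yes refl = refl
    ... | no a≢a'  = adjacent⇒same-component i a i a' (clique i a a' a≢a')

    -- An edge between Xᵢ and Xⱼ (i ≠ j) would put all 2n vertices of
    -- Xᵢ ∪ Xⱼ into one copy of Kₙ, which has only n vertices.
    blocks-nonadjacent : ∀ i j a b → i ≢ j → G (X i a) (X j b) ≡ false
    blocks-nonadjacent i j a b i≢j with G (X i a) (X j b) in adj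
    ... | false = refl
    ... | true  = ⊥-elim (FP.<⇒notInjective (NP.m<m+n n (s≤s z≤n)) offset-inj)
      where
      coord : Fin (n + n) → Fin n × Fin n
      coord z = [ (λ a' → i , a') , (λ b' → j , b') ]′ (splitAt n z)

      coord-inj : Injective _≡_ _≡_ coord
      coord-inj {z} {z'} p = trans (sym (FP.join-splitAt n n z)) (trans (cong (F.join n n) (lemma p)) (FP.join-splitAt n n z'))
        where
        lemma : coord z ≡ coord z' → splitAt n z ≡ splitAt n z'
        lemma p with splitAt n z | splitAt n z'
        ... | inj₁ _ | inj₁ _ = cong (λ c → inj₁ (proj₂ c)) p
        ... | inj₁ _ | inj₂ _ = ⊥-elim (i≢j (cong proj₁ p))
        ... | inj₂ _ | inj₁ _ = ⊥-elim (i≢j (sym (cong proj₁ p)))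
        ... | inj₂ _ | inj₂ _ = cong (λ c → inj₂ (proj₂ c)) p

      vertex : Fin (n + n) → Fin (n * n)
      vertex z = φ (combine (proj₁ (coord z)) (proj₂ (coord z)))

      in-component : ∀ z → quotient {n} n (vertex z) ≡ component i a
      in-component z with splitAt n z
      ... | inj₁ a' = block-in-one-component i a' a
      ... | inj₂ b' = trans (block-in-one-component j b' b) (sym (adjacent⇒same-component i a j b adj))

      offset : Fin (n + n) → Fin n
      offset z = remainder {n} n (vertex z)

      offset-inj : Injective _≡_ _≡_ offset
      offset-inj {z} {z'} p = coord-inj (cong₂ _,_ (proj₁ same-pair) (proj₂ same-pair))
        where
        same-vertex : vertex z ≡ vertex z'
        same-vertex = trans (sym (FP.combine-remQuot {n} n (vertex z)))
                        (trans (cong₂ combine (trans (in-component z) (sym (in-component z'))) p) (FP.combine-remQuot {n} n (vertex z')))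
        same-pair = FP.combine-injective _ _ _ _ (φ-inj same-vertex)

    gᵢ : Fin n → Fin (n + n) ↔ Fin (n + n)
    gᵢ i = proj₁ (isoQ i)

    G-XQ : ∀ i a b → G (X i a) (Q b) ≡ K (Inverse.to (gᵢ i) (vK a)) (Inverse.to (gᵢ i) (wI b))
    G-XQ i a b = trans (sym (cong₂ G (enumXQ-vK X Q i a) (enumXQ-wI X Q i b))) (proj₂ (isoQ i) (vK a) (wI b))

    G-QQ : ∀ i l l' → G (Q l) (Q l') ≡ K (Inverse.to (gᵢ i) (wI l)) (Inverse.to (gᵢ i) (wI l'))
    G-QQ i l l' = trans (sym (cong₂ G (enumXQ-wI X Q i l) (enumXQ-wI X Q i l'))) (proj₂ (isoQ i) (wI l) (wI l'))

    clique-image : ∀ i a b → a ≢ b → K (Inverse.to (gᵢ i) (vK a)) (Inverse.to (gᵢ i) (vK b)) ≡ true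
    clique-image i a b a≢b =
      trans (sym (trans (sym (cong₂ G (enumXQ-vK X Q i a) (enumXQ-vK X Q i b))) (proj₂ (isoQ i) (vK a) (vK b)))) (clique i a b a≢b)

    module Block (i : Fin n) = CliqueImage (gᵢ i) (clique-image i)

    module Naming (xi : Fin n → Fin n → Fin n) (xi-inj : ∀ i → Injective _≡_ _≡_ (xi i))
                  (τ : Fin n → Fin n) (τ-inj : Injective _≡_ _≡_ τ) where
      e : Coord n → Fin N
      e (xv i k) = X i (xi i k)
      e (qv l)   = Q (τ l)

      e-eq : ∀ u v → (e u == e v) ≡ eqC u v
      e-eq (xv i k) (xv j k') = ==-iff _ _ _ to from
        where
        to : X i (xi i k) ≡ X j (xi j k') → eqF i j ∧ eqF k k' ≡ true
        to p with X-inj {i} {j} {xi i k} {xi j k'} p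
        ... | refl , q rewrite xi-inj i q | eqF-refl i | eqF-refl k' = refl
        from : eqF i j ∧ eqF k k' ≡ true → X i (xi i k) ≡ X j (xi j k')
        from p with eqF i j in eij
        from p | true with eqF-true {a = i} {b = j} eij | eqF-true {a = k} {b = k'} p
        ... | refl | refl = refl
      e-eq (xv i k) (qv l)   = ==-iff _ _ _ (λ p → ⊥-elim (X≢Q p)) (λ ())
      e-eq (qv l)   (xv j k) = ==-iff _ _ _ (λ p → ⊥-elim (X≢Q (sym p))) (λ ())
      e-eq (qv l)   (qv l')  = ==-iff _ _ _ to from
        where
        to : Q (τ l) ≡ Q (τ l') → eqF l l' ≡ true
        to p rewrite τ-inj (Q-inj p) = eqF-refl l'
        from : eqF l l' ≡ true → Q (τ l) ≡ Q (τ l')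
        from p = cong (λ z → Q (τ z)) (eqF-true p)

      agree-xx : ∀ i k j k' → G (e (xv i k)) (e (xv j k')) ≡ xxBlocks i k j k'
      agree-xx i k j k' with i F.≟ j
      ... | no i≢j rewrite eqF-false i≢j = blocks-nonadjacent i j _ _ i≢j
      ... | yes refl with k F.≟ k'
      ...   | yes refl rewrite eqF-refl i | eqF-refl k = G-loopless _
      ...   | no k≢k'  rewrite eqF-refl i | eqF-false k≢k' = clique i _ _ (λ p → k≢k' (xi-inj i p))

    centre? : ∀ i → Dec (Σ (Fin n) λ l → Σ (Fin n) λ j → Inverse.to (gᵢ i) (wI l) ≡ vK j)
    centre? i = FP.any? (λ l → onV? (Inverse.to (gᵢ i) (wI l)))
      where
      onV? : ∀ z → Dec (Σ (Fin n) λ j → z ≡ vK j)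
      onV? z with side z
      ... | onV a p = yes (a , p)
      ... | onW b p = no (λ { (a , q) → vK≢wI a b (trans (sym q) p) })

    no-centre⇒typeA : ∀ i → ¬ (Σ (Fin n) λ l → Σ (Fin n) λ j → Inverse.to (gᵢ i) (wI l) ≡ vK j) →
                      ∀ l → Σ (Fin n) λ b → Inverse.to (gᵢ i) (wI l) ≡ wI b
    no-centre⇒typeA i none l with side (Inverse.to (gᵢ i) (wI l))
    ... | onV a p = ⊥-elim (none (l , a , p))
    ... | onW b p = b , p

    Q-typeA : ∀ i → (allW : ∀ l → Σ (Fin n) λ b → Inverse.to (gᵢ i) (wI l) ≡ wI b) → ∀ l l' → G (Q l) (Q l') ≡ false
    Q-typeA i allW l l' = trans (G-QQ i l l') (Block.TypeA.qq-adj i allW l l')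

    Q-centre : ∀ i c j → Inverse.to (gᵢ i) (wI c) ≡ vK j → ∀ l → l ≢ c → G (Q c) (Q l) ≡ true
    Q-centre i c j e l l≢c = trans (G-QQ i c l) (Block.centre-adj i c j e l l≢c)

    Q-leaves : ∀ i c j → Inverse.to (gᵢ i) (wI c) ≡ vK j → ∀ l l' → l ≢ c → l' ≢ c → G (Q l) (Q l') ≡ false
    Q-leaves i c j e l l' l≢c l'≢c = trans (G-QQ i l l') (Block.leaves-nonadj i c j e l l' l≢c l'≢c)

    module WithThird (third : ∀ (a b : Fin n) → Σ (Fin n) λ c → c ≢ a × c ≢ b) where

      -- If block 0 is of type A then so is every block: otherwise G[Q]
      -- would have an edge at the centre of block i.
      typeA-everywhere : (∀ l → Σ (Fin n) λ b → Inverse.to (gᵢ zero) (wI l) ≡ wI b) →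
                         ∀ i l → Σ (Fin n) λ b → Inverse.to (gᵢ i) (wI l) ≡ wI b
      typeA-everywhere allW₀ i l with side (Inverse.to (gᵢ i) (wI l))
      ... | onW b p = b , p
      ... | onV j p = ⊥-elim (true≢false (trans (sym (Q-centre i l j p l' l'≢l)) (Q-typeA zero allW₀ l l')))
        where l'   = proj₁ (third l l)
              l'≢l = proj₁ (proj₂ (third l l))

      -- If q_c is the centre of block 0, it is the centre of every block:
      -- otherwise G[Q] would be edgeless, or a star with another centre,
      -- and n ≥ 3 leaves a q_l to tell these apart.
      same-centre : ∀ c j₀ → Inverse.to (gᵢ zero) (wI c) ≡ vK j₀ → ∀ i → Σ (Fin n) λ j → Inverse.to (gᵢ i) (wI c) ≡ vK j
      same-centre c j₀ e₀ i with side (Inverse.to (gᵢ i) (wI c))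
      ... | onV j p = j , p
      ... | onW b p with centre? i
      ...   | no none = ⊥-elim (true≢false (trans (sym (Q-centre zero c j₀ e₀ l l≢c)) (Q-typeA i (no-centre⇒typeA i none) c l)))
        where l   = proj₁ (third c c)
              l≢c = proj₁ (proj₂ (third c c))
      ...   | yes (c' , j' , e') = ⊥-elim (true≢false (trans (sym (Q-centre zero c j₀ e₀ l l≢c)) (Q-leaves i c' j' e' c l c≢c' l≢c')))
        where l    = proj₁ (third c c')
              l≢c  = proj₁ (proj₂ (third c c'))
              l≢c' = proj₂ (proj₂ (third c c'))
              c≢c' : c ≢ c'
              c≢c' q = vK≢wI _ _ (trans (sym e') (trans (cong (λ z → Inverse.to (gᵢ i) (wI z)) (sym q)) p))

      typeA-form : (∀ i l → Σ (Fin n) λ b → Inverse.to (gᵢ i) (wI l) ≡ wI b) → NormalForm n₁ G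
      typeA-form allW = record { isTypeB = false ; e = e ; e-eq = e-eq ; agree = agree }
        where
        open Naming (λ i → Block.TypeA.xi i (allW i)) (λ i → Block.TypeA.xi-inj i (allW i)) (λ l → l) (λ p → p)
        agree-xq : ∀ i k l → G (e (xv i k)) (e (qv l)) ≡ not (eqF k l)
        agree-xq i k l = trans (G-XQ i _ l) (Block.TypeA.xq-adj i (allW i) k l)
        agree : ∀ u v → G (e u) (e v) ≡ typeA u v
        agree (xv i k) (xv j k') = agree-xx i k j k'
        agree (xv i k) (qv l)    = agree-xq i k l
        agree (qv l)   (xv i k)  = trans (G-sym _ _) (agree-xq i k l)
        agree (qv l)   (qv l')   = Q-typeA zero (allW zero) l l'

      typeB-form : ∀ c → (∀ i → Σ (Fin n) λ j → Inverse.to (gᵢ i) (wI c) ≡ vK j) → NormalForm n₁ G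
      typeB-form c centre = record { isTypeB = true ; e = e ; e-eq = e-eq ; agree = agree }
        where
        τ : Fin n → Fin n
        τ = swap₀ c
        τ-suc≢c : ∀ k → τ (suc k) ≢ c
        τ-suc≢c k p with swap₀-inj c {suc k} {zero} p
        ... | ()
        module B (i : Fin n) = Block.TypeB i c (proj₁ (centre i)) (proj₂ (centre i)) τ (swap₀-inj c) refl
        open Naming B.xi B.xi-inj τ (swap₀-inj c)
        agree-xq : ∀ i k l → G (e (xv i k)) (e (qv l)) ≡ not (eqF k zero) ∧ not (eqF k l)
        agree-xq i k l = trans (G-XQ i _ (τ l)) (B.xq-adj i k l)
        j₀ = proj₁ (centre zero)
        e₀ = proj₂ (centre zero)
        agree-qq : ∀ l l' → G (Q (τ l)) (Q (τ l')) ≡ not (eqF l l') ∧ (eqF l zero ∨ eqF l' zero)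
        agree-qq zero    zero     = G-loopless _
        agree-qq zero    (suc l') = Q-centre zero c j₀ e₀ (τ (suc l')) (τ-suc≢c l')
        agree-qq (suc l) zero     = trans (G-sym _ _) (Q-centre zero c j₀ e₀ (τ (suc l)) (τ-suc≢c l))
        agree-qq (suc l) (suc l') with l F.≟ l'
        ... | yes refl rewrite eqF-refl l = G-loopless _
        ... | no l≢l'  rewrite eqF-false l≢l' = Q-leaves zero c j₀ e₀ _ _ (τ-suc≢c l) (τ-suc≢c l')
        agree : ∀ u v → G (e u) (e v) ≡ typeB u v
        agree (xv i k) (xv j k') = agree-xx i k j k'
        agree (xv i k) (qv l)    = agree-xq i k l
        agree (qv l)   (xv i k)  = trans (G-sym _ _) (agree-xq i k l)
        agree (qv l)   (qv l')   = agree-qq l l'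

      normalForm : NormalForm n₁ G
      normalForm with centre? zero
      ... | no none            = typeA-form (typeA-everywhere (no-centre⇒typeA zero none))
      ... | yes (c , j₀ , e₀)  = typeB-form c (same-centre c j₀ e₀)

    -- For n = 2: in block 0 of either type there are q, x, x' with
    -- q ~ x ~ x' and q ≁ x', an induced P₃.
    inducedP3 : (one : Fin n) → one ≢ zero → InducedP3 G
    inducedP3 one one≢0 with centre? zero
    ... | no none = record { a = Q zero ; b = X zero (xi one) ; c = X zero (xi zero)
                           ; ab = trans (G-sym _ _) (trans (G-XQ zero _ zero) (trans (xq-adj one zero) (cong not (eqF-false one≢0))))
                           ; bc = clique zero _ _ (λ p → one≢0 (xi-inj p))
                           ; ac = trans (G-sym _ _) (trans (G-XQ zero _ zero) (trans (xq-adj zero zero) (cong not (eqF-refl {n} zero))))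
                           ; a≢c = λ p → X≢Q (sym p) }
      where open Block.TypeA zero (no-centre⇒typeA zero none)
    ... | yes (c , j₀ , e₀) = record { a = Q c ; b = X zero (xi one) ; c = X zero (xi zero)
                                     ; ab = trans (G-sym _ _) (trans (G-XQ zero _ c) (trans (xq-adj one zero) (cong (λ b → not b ∧ not b) (eqF-false one≢0))))
                                     ; bc = clique zero _ _ (λ p → one≢0 (xi-inj p))
                                     ; ac = trans (G-sym _ _) (trans (G-XQ zero _ c) (xq-adj zero zero))
                                     ; a≢c = λ p → X≢Q (sym p) }
      where open Block.TypeB zero c j₀ e₀ (swap₀ c) (swap₀-inj c) refl

eqC-sym : ∀ {n} (u v : Coord n) → eqC u v ≡ eqC v u
eqC-sym (xv i k) (xv j k') rewrite eqF-sym i j | eqF-sym k k' = refl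
eqC-sym (xv _ _) (qv _)    = refl
eqC-sym (qv _)   (xv _ _)  = refl
eqC-sym (qv l)   (qv l')   = eqF-sym l l'

lcModel-swap : ∀ {n} (F : Model n) w u v → F u v ≡ F v u → lcModel F w u v ≡ lcModel F w v u
lcModel-swap F w u v Fuv = cong₂ _xor_ Fuv (swap-∧ (F w u) (F w v) (cong not (eqC-sym u v)))
  where
  swap-∧ : ∀ a b {c c'} → c ≡ c' → a ∧ b ∧ c ≡ b ∧ a ∧ c'
  swap-∧ true  true  refl = refl
  swap-∧ true  false refl = refl
  swap-∧ false true  refl = refl
  swap-∧ false false refl = refl

module Models (n₂ : ℕ) where
  n : ℕ
  n = suc (suc n₂)

  one : Fin n
  one = suc zero

  toggle : (Fin n → Bool) → Fin n → Fin n → Bool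
  toggle s i j = eqF j i xor s j

  -- blocks are disjoint; block i is a clique if s i = false and the star
  -- centred at x_{i,0} if s i = true
  xxStars : (Fin n → Bool) → Fin n → Fin n → Fin n → Fin n → Bool
  xxStars s i k j k' = eqF i j ∧ (not (eqF k k') ∧ (not (s i) ∨ (eqF k zero ∨ eqF k' zero)))

  lc-xxStars : ∀ (F : Model n) s i j k j' k' → (∀ a b c d → F (xv a b) (xv c d) ≡ xxStars s a b c d) →
               lcModel F (xv i zero) (xv j k) (xv j' k') ≡ xxStars (toggle s i) j k j' k'
  lc-xxStars F s i j k j' k' hF rewrite hF j k j' k' | hF i zero j k | hF i zero j' k' with i F.≟ j | i F.≟ j'
  ... | yes refl | yes refl rewrite eqF-refl i with s i | k | k'
  ...   | true  | zero  | zero  = refl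
  ...   | true  | zero  | suc b = refl
  ...   | true  | suc a | zero  = refl
  ...   | true  | suc a | suc b with eqF a b
  ...     | true  = refl
  ...     | false = refl
  lc-xxStars F s i j k j' k' hF | yes refl | yes refl | false | zero  | zero  = refl
  lc-xxStars F s i j k j' k' hF | yes refl | yes refl | false | zero  | suc b = refl
  lc-xxStars F s i j k j' k' hF | yes refl | yes refl | false | suc a | zero  = refl
  lc-xxStars F s i j k j' k' hF | yes refl | yes refl | false | suc a | suc b with eqF a b
  ... | true  = refl
  ... | false = refl
  lc-xxStars F s i j k j' k' hF | yes refl | no i≢j' rewrite eqF-refl i | eqF-false i≢j' with s i | k
  ... | true  | zero  = refl
  ... | true  | suc a = refl
  ... | false | zero  = refl
  ... | false | suc a = refl
  lc-xxStars F s i j k j' k' hF | no i≢j | yes refl rewrite eqF-false i≢j | eqF-false (λ p → i≢j (sym p)) = refl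
  lc-xxStars F s i j k j' k' hF | no i≢j | no _ rewrite eqF-false i≢j | eqF-false (λ p → i≢j (sym p)) =
    xor-identityʳ _

  -- Type A, first stage: blocks in s are stars, x_{i,k} ~ q_l as in typeA
  -- (clique blocks) or iff k = 0 or k = l (star blocks); Q ∖ {q₀} is
  -- complete iff p.
  xqA₁ : Bool → Fin n → Fin n → Bool
  xqA₁ true  k l = eqF k zero ∨ eqF k l
  xqA₁ false k l = not (eqF k l)

  modelA₁ : (Fin n → Bool) → Bool → Model n
  modelA₁ s p (xv i k) (xv j k') = xxStars s i k j k'
  modelA₁ s p (xv i k) (qv l)    = xqA₁ (s i) k l
  modelA₁ s p (qv l)   (xv i k)  = xqA₁ (s i) k l
  modelA₁ s p (qv l)   (qv l')   = p ∧ not (eqF l l')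

  avoidsQ₀ : Coord n → Bool
  avoidsQ₀ (xv _ _)      = true
  avoidsQ₀ (qv zero)     = false
  avoidsQ₀ (qv (suc _))  = true

  lc-modelA₁-xq : ∀ s p i j k l → lcModel (modelA₁ s p) (xv i zero) (xv j k) (qv (suc l)) ≡ xqA₁ (toggle s i j) k (suc l)
  lc-modelA₁-xq s p i j k l with i F.≟ j
  ... | yes refl rewrite eqF-refl i with s i | k
  ...   | true  | zero  = refl
  ...   | false | zero  = refl
  ...   | true  | suc a with eqF a l
  ...     | true  = refl
  ...     | false = refl
  lc-modelA₁-xq s p i j k l | yes refl | false | suc a with eqF a l
  ... | true  = refl
  ... | false = refl
  lc-modelA₁-xq s p i j k l | no i≢j rewrite eqF-false i≢j | eqF-false (λ q → i≢j (sym q)) = xor-identityʳ _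

  -- x_{i,0} sees all of Q ∖ {q₀}, so it complements Q ∖ {q₀}
  lc-modelA₁-qq : ∀ s p i l l' → lcModel (modelA₁ s p) (xv i zero) (qv (suc l)) (qv (suc l')) ≡ not p ∧ not (eqF l l')
  lc-modelA₁-qq s p i l l' with s i | p | eqF l l'
  ... | true  | true  | true  = refl
  ... | true  | true  | false = refl
  ... | true  | false | true  = refl
  ... | true  | false | false = refl
  ... | false | true  | true  = refl
  ... | false | true  | false = refl
  ... | false | false | true  = refl
  ... | false | false | false = refl

  lc-modelA₁ : ∀ s p i u v → avoidsQ₀ u ≡ true → avoidsQ₀ v ≡ true →
               lcModel (modelA₁ s p) (xv i zero) u v ≡ modelA₁ (toggle s i) (not p) u v
  lc-modelA₁ s p i (xv j k) (xv j' k') _ _ = lc-xxStars (modelA₁ s p) s i j k j' k' (λ _ _ _ _ → refl)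
  lc-modelA₁ s p i (xv j k) (qv (suc l)) _ _ = lc-modelA₁-xq s p i j k l
  lc-modelA₁ s p i (qv (suc l)) (xv j k) _ _ = trans (lcModel-swap (modelA₁ s p) (xv i zero) (qv (suc l)) (xv j k) refl) (lc-modelA₁-xq s p i j k l)
  lc-modelA₁ s p i (qv (suc l)) (qv (suc l')) _ _ = lc-modelA₁-qq s p i l l'

  -- Type A, second stage (on blocks and q's other than 0): every block is
  -- a star, x_{i,k} ~ q_l iff k = l ≠ 0, and x_{i,0} ~ q_l iff not t i l.
  avoids₀ : Coord n → Bool
  avoids₀ (xv i _) = not (eqF i zero)
  avoids₀ (qv l)   = not (eqF l zero)

  xqA₂ : (Fin n → Fin n → Bool) → Fin n → Fin n → Fin n → Bool
  xqA₂ t i zero    l = not (t i l)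
  xqA₂ t i (suc k) l = eqF (suc k) l

  xxStar : Fin n → Fin n → Fin n → Fin n → Bool
  xxStar i k j k' = eqF i j ∧ (not (eqF k k') ∧ (eqF k zero ∨ eqF k' zero))

  modelA₂ : (Fin n → Fin n → Bool) → Model n
  modelA₂ t (xv i k) (xv j k') = xxStar i k j k'
  modelA₂ t (xv i k) (qv l)    = xqA₂ t i k l
  modelA₂ t (qv l)   (xv i k)  = xqA₂ t i k l
  modelA₂ t (qv l)   (qv l')   = false

  toggle₂ : (Fin n → Fin n → Bool) → Fin n → Fin n → Fin n → Fin n → Bool
  toggle₂ t i b j l = (eqF i j ∧ eqF b l) xor t j l

  -- Local complementation at the leaf x_{i,b} (b ≠ 0), whose neighbours
  -- are x_{i,0} and q_b, only toggles the edge x_{i,0} q_b.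
  lc-modelA₂-xx : ∀ t i b j k j' k' → lcModel (modelA₂ t) (xv i (suc b)) (xv j k) (xv j' k') ≡ xxStar j k j' k'
  lc-modelA₂-xx t i b j k j' k' with i F.≟ j | i F.≟ j'
  ... | yes refl | yes refl rewrite eqF-refl i with k | k'
  ...   | zero | zero = refl
  ...   | zero | suc c with eqF b c
  ...     | true  = refl
  ...     | false = refl
  lc-modelA₂-xx t i b j k j' k' | yes refl | yes refl | suc a | zero with eqF b a
  ... | true  = refl
  ... | false = refl
  lc-modelA₂-xx t i b j k j' k' | yes refl | yes refl | suc a | suc c with eqF b a | eqF a c
  ... | x | z rewrite ∧-zeroʳ (not x) | xor-identityʳ (not z ∧ false) = refl
  lc-modelA₂-xx t i b j k j' k' | yes refl | no i≢j' rewrite eqF-refl i | eqF-false i≢j' with k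
  ... | zero  = xor-identityʳ _
  ... | suc a with eqF b a
  ...   | true  = xor-identityʳ _
  ...   | false = xor-identityʳ _
  lc-modelA₂-xx t i b j k j' k' | no i≢j | _ rewrite eqF-false i≢j = xor-identityʳ _

  lc-modelA₂-xq : ∀ t i b j k l → lcModel (modelA₂ t) (xv i (suc b)) (xv j k) (qv (suc l)) ≡ xqA₂ (toggle₂ t i (suc b)) j k (suc l)
  lc-modelA₂-xq t i b j k l with i F.≟ j
  ... | yes refl with k
  ...   | zero rewrite eqF-refl i with eqF b l | t i (suc l)
  ...     | true  | true  = refl
  ...     | true  | false = refl
  ...     | false | true  = refl
  ...     | false | false = refl
  lc-modelA₂-xq t i b j k l | yes refl | suc a rewrite eqF-refl i with eqF b a
  ... | true  = xor-identityʳ _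
  ... | false = xor-identityʳ _
  lc-modelA₂-xq t i b j k l | no i≢j with k
  ... | zero  rewrite eqF-false i≢j = xor-identityʳ _
  ... | suc a rewrite eqF-false i≢j = xor-identityʳ _

  lc-modelA₂-qq : ∀ t i b l l' → lcModel (modelA₂ t) (xv i (suc b)) (qv (suc l)) (qv (suc l')) ≡ false
  lc-modelA₂-qq t i b l l' with b F.≟ l | b F.≟ l'
  ... | yes refl | yes refl rewrite eqF-refl b = refl
  ... | yes refl | no b≢l'  rewrite eqF-refl b | eqF-false b≢l' = refl
  ... | no b≢l   | _        rewrite eqF-false b≢l = refl

  lc-modelA₂ : ∀ t i b u v → avoids₀ u ≡ true → avoids₀ v ≡ true →
               lcModel (modelA₂ t) (xv i (suc b)) u v ≡ modelA₂ (toggle₂ t i (suc b)) u v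
  lc-modelA₂ t i b (xv j k)     (xv j' k')    _ _ = lc-modelA₂-xx t i b j k j' k'
  lc-modelA₂ t i b (xv j k)     (qv (suc l))  _ _ = lc-modelA₂-xq t i b j k l
  lc-modelA₂ t i b (qv (suc l)) (xv j k)      _ _ =
    trans (lcModel-swap (modelA₂ t) (xv i (suc b)) (qv (suc l)) (xv j k) refl) (lc-modelA₂-xq t i b j k l)
  lc-modelA₂ t i b (qv (suc l)) (qv (suc l')) _ _ = lc-modelA₂-qq t i b l l'

  xqB : Fin n → Fin n → Bool
  xqB k l = not (eqF k zero) ∧ not (eqF k l)

  modelB₁ : (Fin n → Bool) → Model n
  modelB₁ s (xv i k) (xv j k') = xxStars s i k j k'
  modelB₁ s (xv i k) (qv l)    = xqB k l
  modelB₁ s (qv l)   (xv i k)  = xqB k l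
  modelB₁ s (qv l)   (qv l')   = not (eqF l l') ∧ (eqF l zero ∨ eqF l' zero)

  -- x_{i,0} has no neighbour outside its block
  lc-modelB₁ : ∀ s i u v → lcModel (modelB₁ s) (xv i zero) u v ≡ modelB₁ (toggle s i) u v
  lc-modelB₁ s i (xv j k) (xv j' k') = lc-xxStars (modelB₁ s) s i j k j' k' (λ _ _ _ _ → refl)
  lc-modelB₁ s i (xv j k) (qv l) rewrite ∧-zeroʳ (xxStars s i zero j k) = xor-identityʳ _
  lc-modelB₁ s i (qv l)   (xv j k)  = xor-identityʳ _
  lc-modelB₁ s i (qv l)   (qv l')   = xor-identityʳ _

  -- The comb: blocks 1,…,n-1 are stars centred at x_{i,0}, x_{i,k} ~ q_k
  -- for k ≠ 0, and Q is independent; onComb drops block 0, q₀ and q₁.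
  onComb : Coord n → Bool
  onComb (xv i _)            = not (eqF i zero)
  onComb (qv zero)           = false
  onComb (qv (suc zero))     = false
  onComb (qv (suc (suc _)))  = true

  comb : Model n
  comb (xv i k) (xv j k') = xxStar i k j k'
  comb (xv i k) (qv l)    = not (eqF k zero) ∧ eqF k l
  comb (qv l)   (xv i k)  = not (eqF k zero) ∧ eqF k l
  comb (qv l)   (qv l')   = false

  modelB₄ : Model n
  modelB₄ = lcModel (lcModel (lcModel (modelB₁ (λ _ → true)) (xv zero one)) (qv zero)) (xv zero zero)

  modelB₄-xx : ∀ i k j k' → modelB₄ (xv (suc i) k) (xv (suc j) k') ≡ comb (xv (suc i) k) (xv (suc j) k')
  modelB₄-xx i zero                 j zero                 with eqF i j
  ... | true = refl
  ... | false = refl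
  modelB₄-xx i zero                 j (suc zero)           with eqF i j
  ... | true = refl
  ... | false = refl
  modelB₄-xx i zero                 j (suc (suc _))        with eqF i j
  ... | true = refl
  ... | false = refl
  modelB₄-xx i (suc zero)           j zero                 with eqF i j
  ... | true = refl
  ... | false = refl
  modelB₄-xx i (suc zero)           j (suc zero)           with eqF i j
  ... | true = refl
  ... | false = refl
  modelB₄-xx i (suc zero)           j (suc (suc _))        with eqF i j
  ... | true = refl
  ... | false = refl
  modelB₄-xx i (suc (suc a))        j zero                 with eqF i j
  ... | true = refl
  ... | false = refl
  modelB₄-xx i (suc (suc a))        j (suc zero)           with eqF i j
  ... | true = refl
  ... | false = refl
  modelB₄-xx i (suc (suc a))        j (suc (suc c))        with eqF i j | eqF a c
  ... | true  | true  = refl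
  ... | true  | false = refl
  ... | false | true  = refl
  ... | false | false = refl

  modelB₄-xq : ∀ i k l → modelB₄ (xv (suc i) k) (qv (suc (suc l))) ≡ comb (xv (suc i) k) (qv (suc (suc l)))
  modelB₄-xq i zero          l = refl
  modelB₄-xq i (suc zero)    l = refl
  modelB₄-xq i (suc (suc a)) l with eqF a l
  ... | true  = refl
  ... | false = refl

  modelB₄-qx : ∀ i k l → modelB₄ (qv (suc (suc l))) (xv (suc i) k) ≡ comb (qv (suc (suc l))) (xv (suc i) k)
  modelB₄-qx i zero          l = refl
  modelB₄-qx i (suc zero)    l = refl
  modelB₄-qx i (suc (suc a)) l with eqF a l
  ... | true  = refl
  ... | false = refl

  modelB₄-qq : ∀ l l' → modelB₄ (qv (suc (suc l))) (qv (suc (suc l'))) ≡ false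
  modelB₄-qq l l' with eqF l l'
  ... | true  = refl
  ... | false = refl

  modelB₄-comb : ∀ u v → onComb u ≡ true → onComb v ≡ true → modelB₄ u v ≡ comb u v
  modelB₄-comb (xv (suc i) k)         (xv (suc j) k')        _ _ = modelB₄-xx i k j k'
  modelB₄-comb (xv (suc i) k)         (qv (suc (suc l)))     _ _ = modelB₄-xq i k l
  modelB₄-comb (qv (suc (suc l)))     (xv (suc i) k)         _ _ =     modelB₄-qx i k l
  modelB₄-comb (qv (suc (suc l)))     (qv (suc (suc l')))    _ _ = modelB₄-qq l l'

-- Parity of the number of elements of a list satisfying a predicate; it
-- governs the result of a sequence of toggles.
parity : ∀ {A : Set} → (A → Bool) → List A → Bool
parity P []      = false
parity P (x ∷ L) = P x xor parity P L

parity-++ : ∀ {A : Set} (P : A → Bool) L L' → parity P (L ++ L') ≡ parity P L xor parity P L'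
parity-++ P []      L' = refl
parity-++ P (x ∷ L) L' rewrite parity-++ P L L' = sym (xor-assoc (P x) (parity P L) (parity P L'))

parity-map : ∀ {A B : Set} (P : B → Bool) (f : A → B) L → parity P (map f L) ≡ parity (λ x → P (f x)) L
parity-map P f []      = refl
parity-map P f (x ∷ L) = cong (P (f x) xor_) (parity-map P f L)

parity-cong : ∀ {A : Set} {P R : A → Bool} → (∀ x → P x ≡ R x) → ∀ L → parity P L ≡ parity R L
parity-cong P≗R []      = refl
parity-cong P≗R (x ∷ L) = cong₂ _xor_ (P≗R x) (parity-cong P≗R L)

pairs : ∀ {A B : Set} → List A → List B → List (A × B)
pairs []       bs = []
pairs (a ∷ as) bs = map (a ,_) bs ++ pairs as bs

parity-pairs : ∀ {A B : Set} (P : A → Bool) (R : B → Bool) as bs →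
               parity (λ ab → P (proj₁ ab) ∧ R (proj₂ ab)) (pairs as bs) ≡ parity P as ∧ parity R bs
parity-pairs P R []       bs = refl
parity-pairs P R (a ∷ as) bs
  rewrite parity-++ (λ ab → P (proj₁ ab) ∧ R (proj₂ ab)) (map (a ,_) bs) (pairs as bs)
        | parity-map (λ ab → P (proj₁ ab) ∧ R (proj₂ ab)) (a ,_) bs
        | parity-pairs P R as bs with P a
... | true  with parity P as | parity R bs
...   | true  | true  = refl
...   | true  | false = refl
...   | false | true  = refl
...   | false | false = refl
parity-pairs P R (a ∷ as) bs | false = cong (_xor parity P as ∧ parity R bs) (parity-false bs)
  where
  parity-false : ∀ L → parity (λ _ → false) L ≡ false
  parity-false []      = refl
  parity-false (_ ∷ L) = parity-false L

padToEven : ∀ {A : Set} → A → List A → List A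
padToEven a L = (if parity (λ _ → true) L then a ∷ [] else []) ++ L

padToEven-even : ∀ {A : Set} (a : A) L → parity (λ _ → true) (padToEven a L) ≡ false
padToEven-even a L rewrite parity-++ (λ _ → true) (if parity (λ _ → true) L then a ∷ [] else []) L
  with parity (λ _ → true) L
... | true  = refl
... | false = refl

enumFin : (k : ℕ) → List (Fin k)
enumFin zero    = []
enumFin (suc k) = zero ∷ map suc (enumFin k)

parity-enumFin : ∀ k (x : Fin k) → parity (λ y → eqF y x) (enumFin k) ≡ true
parity-enumFin (suc k) zero    = cong not (trans (parity-map (λ y → eqF y zero) suc (enumFin k)) (parity-zero (enumFin k)))
  where
  parity-zero : ∀ L → parity (λ (y : Fin k) → false) L ≡ false
  parity-zero []      = refl
  parity-zero (_ ∷ L) = parity-zero L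
parity-enumFin (suc k) (suc x) = trans (parity-map (λ y → eqF y (suc x)) suc (enumFin k)) (parity-enumFin k x)

xor-shift : ∀ a r s → r xor (a xor s) ≡ (a xor r) xor s
xor-shift a r s = trans (sym (xor-assoc r a s)) (cong (_xor s) (xor-comm r a))

module Sequences (n₂ : ℕ) {N : ℕ} (e : Coord (suc (suc n₂)) → Fin N) (e-eq : ∀ u v → (e u == e v) ≡ eqC u v) where
  open Models n₂
  open Agreement e e-eq

  toggles : (Fin n → Bool) → List (Fin n) → Fin n → Bool
  toggles s []      = s
  toggles s (i ∷ L) = toggles (toggle s i) L

  toggles-val : ∀ L s j → toggles s L j ≡ parity (λ i → eqF i j) L xor s j
  toggles-val []      s j = refl
  toggles-val (i ∷ L) s j = trans (toggles-val L (toggle s i) j)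
                              (trans (xor-shift (eqF j i) _ (s j)) (cong (λ b → (b xor parity (λ i → eqF i j) L) xor s j) (eqF-sym j i)))

  flips : ∀ {A : Set} → Bool → List A → Bool
  flips p []      = p
  flips p (_ ∷ L) = flips (not p) L

  flips-val : ∀ {A : Set} (L : List A) p → flips p L ≡ parity (λ _ → true) L xor p
  flips-val []      p = refl
  flips-val (_ ∷ L) p = trans (flips-val L (not p)) (xor-shift true (parity (λ _ → true) L) p)

  toggles₂ : (Fin n → Fin n → Bool) → List (Fin (suc n₂) × Fin (suc n₂)) → Fin n → Fin n → Bool
  toggles₂ t []            = t
  toggles₂ t ((a , b) ∷ L) = toggles₂ (toggle₂ t (suc a) (suc b)) L

  toggles₂-val : ∀ L t j l → toggles₂ t L j l ≡ parity (λ ab → eqF (suc (proj₁ ab)) j ∧ eqF (suc (proj₂ ab)) l) L xor t j l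
  toggles₂-val []            t j l = refl
  toggles₂-val ((a , b) ∷ L) t j l = trans (toggles₂-val L (toggle₂ t (suc a) (suc b)) j l) (xor-shift (eqF (suc a) j ∧ eqF (suc b) l) _ (t j l))

  centre : Fin n → Fin N
  centre i = e (xv i zero)

  leafVertex : Fin (suc n₂) × Fin (suc n₂) → Fin N
  leafVertex (a , b) = e (xv (suc a) (suc b))

  phaseA₁ : ∀ L s p B → Agrees avoidsQ₀ B (modelA₁ s p) →
            Agrees avoidsQ₀ (applyLCs B (map centre L)) (modelA₁ (toggles s L) (flips p L))
  phaseA₁ []      s p B ag = ag
  phaseA₁ (i ∷ L) s p B ag = phaseA₁ L (toggle s i) (not p) _ (agrees-cong (lc-modelA₁ s p i) (agrees-lc (xv i zero) refl ag))

  phaseA₂ : ∀ L t B → Agrees avoids₀ B (modelA₂ t) → Agrees avoids₀ (applyLCs B (map leafVertex L)) (modelA₂ (toggles₂ t L))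
  phaseA₂ []            t B ag = ag
  phaseA₂ ((a , b) ∷ L) t B ag =
    phaseA₂ L (toggle₂ t (suc a) (suc b)) _ (agrees-cong (lc-modelA₂ t (suc a) b) (agrees-lc (xv (suc a) (suc b)) refl ag))

  phaseB₁ : ∀ L s B → Agrees (λ _ → true) B (modelB₁ s) → Agrees (λ _ → true) (applyLCs B (map centre L)) (modelB₁ (toggles s L))
  phaseB₁ []      s B ag = ag
  phaseB₁ (i ∷ L) s B ag = phaseB₁ L (toggle s i) _ (agrees-cong (λ u v _ _ → lc-modelB₁ s i u v) (agrees-lc (xv i zero) refl ag))

  -- Type A: first the centres of blocks 1,…,n-1 (and of block 0 if
  -- needed to make their number even, so Q stays independent), then every
  -- leaf x_{i,k} with i, k ≥ 1.
  centresA : List (Fin n)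
  centresA = padToEven zero (map suc (enumFin (suc n₂)))

  leavesA : List (Fin (suc n₂) × Fin (suc n₂))
  leavesA = pairs (enumFin (suc n₂)) (enumFin (suc n₂))

  centresA-stars : ∀ i → toggles (λ _ → false) centresA (suc i) ≡ true
  centresA-stars i =
    begin
      toggles (λ _ → false) centresA (suc i)
    ≡⟨ trans (toggles-val centresA (λ _ → false) (suc i)) (xor-identityʳ _) ⟩
      parity (λ y → eqF y (suc i)) centresA
    ≡⟨ parity-++ (λ y → eqF y (suc i)) (if parity (λ _ → true) (map suc (enumFin (suc n₂))) then zero ∷ [] else []) _ ⟩
      parity (λ y → eqF y (suc i)) (if parity (λ _ → true) (map suc (enumFin (suc n₂))) then zero ∷ [] else []) xor
      parity (λ y → eqF y (suc i)) (map suc (enumFin (suc n₂)))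
    ≡⟨ cong₂ _xor_ (padding-misses (parity (λ _ → true) (map suc (enumFin (suc n₂)))))
                   (trans (parity-map (λ y → eqF y (suc i)) suc (enumFin (suc n₂))) (parity-enumFin (suc n₂) i)) ⟩
      true
    ∎
    where
    open ≡-Reasoning
    padding-misses : ∀ b → parity (λ y → eqF y (suc i)) (if b then zero ∷ [] else []) ≡ false
    padding-misses true  = refl
    padding-misses false = refl

  leavesA-all : ∀ i l → toggles₂ (λ _ _ → false) leavesA (suc i) (suc l) ≡ true
  leavesA-all i l
    rewrite toggles₂-val leavesA (λ _ _ → false) (suc i) (suc l)
          | xor-identityʳ (parity (λ ab → eqF (suc (proj₁ ab)) (suc i) ∧ eqF (suc (proj₂ ab)) (suc l)) leavesA)
          | parity-pairs (λ a → eqF a i) (λ b → eqF b l) (enumFin (suc n₂)) (enumFin (suc n₂))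
          | parity-enumFin (suc n₂) i | parity-enumFin (suc n₂) l = refl

  typeA-as-modelA₁ : ∀ u v → avoidsQ₀ u ≡ true → avoidsQ₀ v ≡ true → typeA u v ≡ modelA₁ (λ _ → false) false u v
  typeA-as-modelA₁ (xv i k) (xv j k') _ _ rewrite ∧-identityʳ (not (eqF k k')) = refl
  typeA-as-modelA₁ (xv i k) (qv l)    _ _ = refl
  typeA-as-modelA₁ (qv l)   (xv i k)  _ _ = refl
  typeA-as-modelA₁ (qv l)   (qv l')   _ _ = refl

  modelA₁-as-modelA₂ : ∀ s → (∀ i → s (suc i) ≡ true) → ∀ u v → avoids₀ u ≡ true → avoids₀ v ≡ true →
                       modelA₁ s false u v ≡ modelA₂ (λ _ _ → false) u v
  modelA₁-as-modelA₂ s stars (xv (suc i) k)       (xv j k')           _ _ rewrite stars i = refl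
  modelA₁-as-modelA₂ s stars (xv (suc i) zero)    (qv l)              _ _ rewrite stars i = refl
  modelA₁-as-modelA₂ s stars (xv (suc i) (suc k)) (qv l)              _ _ rewrite stars i = refl
  modelA₁-as-modelA₂ s stars (qv l)               (xv (suc i) zero)   _ _ rewrite stars i = refl
  modelA₁-as-modelA₂ s stars (qv l)               (xv (suc i) (suc k)) _ _ rewrite stars i = refl
  modelA₁-as-modelA₂ s stars (qv l)               (qv l')             _ _ = refl

  modelA₂-as-comb : ∀ t → (∀ i l → t (suc i) (suc l) ≡ true) → ∀ u v → onComb u ≡ true → onComb v ≡ true → modelA₂ t u v ≡ comb u v
  modelA₂-as-comb t all (xv i k)             (xv j k')            _ _ = refl
  modelA₂-as-comb t all (xv (suc i) zero)    (qv (suc l))         _ _ rewrite all i l = refl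
  modelA₂-as-comb t all (xv (suc i) (suc k)) (qv l)               _ _ = refl
  modelA₂-as-comb t all (qv (suc l))         (xv (suc i) zero)    _ _ rewrite all i l = refl
  modelA₂-as-comb t all (qv l)               (xv (suc i) (suc k)) _ _ = refl
  modelA₂-as-comb t all (qv l)               (qv l')              _ _ = refl

  avoids₀⇒avoidsQ₀ : ∀ u → avoids₀ u ≡ true → avoidsQ₀ u ≡ true
  avoids₀⇒avoidsQ₀ (xv _ _)     _ = refl
  avoids₀⇒avoidsQ₀ (qv (suc _)) _ = refl

  onComb⇒avoids₀ : ∀ u → onComb u ≡ true → avoids₀ u ≡ true
  onComb⇒avoids₀ (xv _ _)           p = p
  onComb⇒avoids₀ (qv (suc (suc _))) _ = refl

  ReachesComb : Adj N → Set
  ReachesComb G = Σ (Adj N) λ B → LCSeq G B × Agrees onComb B comb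

  typeA⇒comb : (G : Adj N) → (∀ u v → G (e u) (e v) ≡ typeA u v) → ReachesComb G
  typeA⇒comb G agree = B₂ , lcseq-applyLCs (lcseq-applyLCs lc-refl (map centre centresA)) (map leafVertex leavesA) , on-comb
    where
    B₁ B₂ : Adj N
    B₁ = applyLCs G (map centre centresA)
    B₂ = applyLCs B₁ (map leafVertex leavesA)
    stage₁ : Agrees avoidsQ₀ B₁ (modelA₁ (toggles (λ _ → false) centresA) (flips false centresA))
    stage₁ = phaseA₁ centresA (λ _ → false) false G (agrees-cong typeA-as-modelA₁ (agrees (λ u v _ _ → agree u v)))
    Q-independent : flips false centresA ≡ false
    Q-independent = trans (flips-val centresA false) (cong (_xor false) (padToEven-even zero (map suc (enumFin (suc n₂)))))
    stage₂ : Agrees avoids₀ B₁ (modelA₂ (λ _ _ → false))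
    stage₂ = agrees-cong (λ u v Pu Pv → trans (cong (λ p → modelA₁ (toggles (λ _ → false) centresA) p u v) Q-independent) (modelA₁-as-modelA₂ _ centresA-stars u v Pu Pv))
                         (agrees-restrict avoids₀⇒avoidsQ₀ stage₁)
    on-comb : Agrees onComb B₂ comb
    on-comb = agrees-cong (modelA₂-as-comb _ leavesA-all) (agrees-restrict onComb⇒avoids₀ (phaseA₂ leavesA (λ _ _ → false) B₁ stage₂))

  typeB-as-modelB₁ : ∀ u v → typeB u v ≡ modelB₁ (λ _ → false) u v
  typeB-as-modelB₁ (xv i k) (xv j k') rewrite ∧-identityʳ (not (eqF k k')) = refl
  typeB-as-modelB₁ (xv i k) (qv l)    = refl
  typeB-as-modelB₁ (qv l)   (xv i k)  = refl
  typeB-as-modelB₁ (qv l)   (qv l')   = refl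

  allStars : ∀ u v → modelB₁ (toggles (λ _ → false) (enumFin n)) u v ≡ modelB₁ (λ _ → true) u v
  allStars (xv i k) (xv j k') rewrite toggles-val (enumFin n) (λ _ → false) i | xor-identityʳ (parity (λ y → eqF y i) (enumFin n))
                                    | parity-enumFin n i = refl
  allStars (xv i k) (qv l)    = refl
  allStars (qv l)   (xv i k)  = refl
  allStars (qv l)   (qv l')   = refl

  typeB⇒comb : (G : Adj N) → (∀ u v → G (e u) (e v) ≡ typeB u v) → ReachesComb G
  typeB⇒comb G agree = B₄ , lc-step (lc-step (lc-step (lcseq-applyLCs lc-refl (map centre (enumFin n))) _) _) _ , on-comb
    where
    B₁ B₄ : Adj N
    B₁ = applyLCs G (map centre (enumFin n))
    B₄ = localComp (localComp (localComp B₁ (e (xv zero one))) (e (qv zero))) (e (xv zero zero))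
    stage₁ : Agrees (λ _ → true) B₁ (modelB₁ (λ _ → true))
    stage₁ = agrees-cong (λ u v _ _ → allStars u v)
               (phaseB₁ (enumFin n) (λ _ → false) G (agrees-cong (λ u v _ _ → typeB-as-modelB₁ u v) (agrees (λ u v _ _ → agree u v))))
    on-comb : Agrees onComb B₄ comb
    on-comb = agrees-cong modelB₄-comb
                (agrees-restrict (λ _ _ → refl) (agrees-lc (xv zero zero) refl (agrees-lc (qv zero) refl (agrees-lc (xv zero one) refl stage₁))))

  normal⇒comb : (G : Adj N) (isTypeB : Bool) → (∀ u v → G (e u) (e v) ≡ normalModel isTypeB u v) → ReachesComb G
  normal⇒comb G false = typeA⇒comb G
  normal⇒comb G true  = typeB⇒comb G

-- The comb with natural-number coordinates, where positions on the path
-- can be computed arithmetically.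
data Pt : Set where
  xD : ℕ → ℕ → Pt
  qD : ℕ → Pt

combℕ : Pt → Pt → Bool
combℕ (xD i k) (xD j k') = (i ≡ᵇ j) ∧ (not (k ≡ᵇ k') ∧ ((k ≡ᵇ 0) ∨ (k' ≡ᵇ 0)))
combℕ (xD i k) (qD l)    = not (k ≡ᵇ 0) ∧ (k ≡ᵇ l)
combℕ (qD l)   (xD i k)  = not (k ≡ᵇ 0) ∧ (k ≡ᵇ l)
combℕ (qD l)   (qD l')   = false

-- Position 4b + r of the path is slot r of gadget b:
--   x_{b+1,b+1}, x_{b+1,0}, x_{b+1,b+2}, q_{b+2},
-- except that the last gadget has x_{b+1,1} in slot 2 and no slot 3.
pathVertex : ℕ → ℕ → Bool → Pt
pathVertex b 0                   _     = xD (suc b) (suc b)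
pathVertex b 1                   _     = xD (suc b) 0
pathVertex b 2                   true  = xD (suc b) 1
pathVertex b 2                   false = xD (suc b) (suc (suc b))
pathVertex b (suc (suc (suc _))) _     = qD (suc (suc b))

follows : ℕ → ℕ → ℕ → ℕ → Bool
follows zero    r' b b' = (r' ≡ᵇ 3) ∧ (b ≡ᵇ suc b')
follows (suc r) r' b b' = (r ≡ᵇ r') ∧ (b ≡ᵇ b')

follows-correct : ∀ b r b' r' → r < 4 → r' < 4 → ((b * 4 + r) ≡ᵇ suc (b' * 4 + r')) ≡ follows r r' b b'
follows-correct (suc b) zero    (suc b') r' r<4 r'<4 = follows-correct b zero b' r' (s≤s z≤n) r'<4
follows-correct (suc b) (suc r) (suc b') r' r<4 r'<4 = follows-correct b (suc r) b' r' r<4 r'<4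
follows-correct zero    zero    b'       r' _   _    = sym (∧-zeroʳ _)
follows-correct zero    (suc r) zero     r' _   _    = sym (∧-identityʳ _)
follows-correct zero    (suc r) (suc b') r' r<4 _    = trans (too-small r r<4) (sym (∧-zeroʳ _))
  where
  too-small : ∀ r → suc r < 4 → (r ≡ᵇ suc (suc (suc (suc (b' * 4 + r'))))) ≡ false
  too-small 0 _ = refl
  too-small 1 _ = refl
  too-small 2 _ = refl
  too-small (suc (suc (suc _))) (s≤s (s≤s (s≤s (s≤s ()))))
follows-correct (suc b) zero    zero 0 _ _ = refl
follows-correct (suc b) zero    zero 1 _ _ = refl
follows-correct (suc b) zero    zero 2 _ _ = refl
follows-correct (suc zero) zero   zero 3 _ _ = refl
follows-correct (suc (suc b)) zero zero 3 _ _ = refl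
follows-correct (suc b) (suc r) zero 0 _ _ = sym (∧-zeroʳ _)
follows-correct (suc b) (suc r) zero 1 _ _ = sym (∧-zeroʳ _)
follows-correct (suc b) (suc r) zero 2 _ _ = sym (∧-zeroʳ _)
follows-correct (suc b) (suc r) zero 3 _ _ rewrite NP.+-suc (b * 4) r = sym (∧-zeroʳ _)
follows-correct (suc b) r zero (suc (suc (suc (suc _)))) _ (s≤s (s≤s (s≤s (s≤s ()))))

≡ᵇ-refl : ∀ m → (m ≡ᵇ m) ≡ true
≡ᵇ-refl zero    = refl
≡ᵇ-refl (suc m) = ≡ᵇ-refl m

≡ᵇ-false : ∀ {m n} → m ≢ n → (m ≡ᵇ n) ≡ false
≡ᵇ-false {zero}  {zero}  m≢n = ⊥-elim (m≢n refl)
≡ᵇ-false {zero}  {suc n} _   = refl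
≡ᵇ-false {suc m} {zero}  _   = refl
≡ᵇ-false {suc m} {suc n} m≢n = ≡ᵇ-false (λ p → m≢n (cong suc p))

≡ᵇ-sym : ∀ m n → (m ≡ᵇ n) ≡ (n ≡ᵇ m)
≡ᵇ-sym zero    zero    = refl
≡ᵇ-sym zero    (suc n) = refl
≡ᵇ-sym (suc m) zero    = refl
≡ᵇ-sym (suc m) (suc n) = ≡ᵇ-sym m n

record Slot (Lst : ℕ) (last : Bool) (b r : ℕ) : Set where
  field
    r<4    : r < 4
    last≡  : last ≡ (b ≡ᵇ Lst)
    no-q   : r ≡ 3 → last ≡ false

last≢with-q : ∀ {Lst b b' r} → Slot Lst true b r → Slot Lst false b' 3 → b ≢ b'
last≢with-q s s' refl = true≢false (trans (Slot.last≡ s) (sym (Slot.last≡ s')))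

CombStep : Bool → ℕ → ℕ → Bool → ℕ → ℕ → Set
CombStep f b r f' b' r' = combℕ (pathVertex b r f) (pathVertex b' r' f') ≡ follows r r' b b' ∨ follows r' r b' b

comb-from-slot₀ : ∀ f b f' b' r' → r' < 4 → CombStep f b 0 f' b' r'
comb-from-slot₀ f b f'     b' 0 _ with b ≡ᵇ b'
... | true  = refl
... | false = refl
comb-from-slot₀ f b f'     b' 1 _ rewrite ≡ᵇ-sym b' b with b ≡ᵇ b'
... | true  = refl
... | false = refl
comb-from-slot₀ f b true   b' 2 _ with b ≡ᵇ b' | b ≡ᵇ 0
... | true  | true  = refl
... | true  | false = refl
... | false | _     = refl
comb-from-slot₀ f b false  b' 2 _ with b ≡ᵇ b' | b ≡ᵇ suc b'
... | true  | true  = refl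
... | true  | false = refl
... | false | _     = refl
comb-from-slot₀ f b f'     b' 3 _ with b ≡ᵇ suc b'
... | true  = refl
... | false = refl
comb-from-slot₀ f b f' b' (suc (suc (suc (suc _)))) (s≤s (s≤s (s≤s (s≤s ()))))

comb-from-slot₁ : ∀ f b f' b' r' → r' < 4 → CombStep f b 1 f' b' r'
comb-from-slot₁ f b f'    b' 0 _ with b ≡ᵇ b'
... | true  = refl
... | false = refl
comb-from-slot₁ f b f'    b' 1 _ with b ≡ᵇ b'
... | true  = refl
... | false = refl
comb-from-slot₁ f b true  b' 2 _ rewrite ≡ᵇ-sym b' b with b ≡ᵇ b'
... | true  = refl
... | false = refl
comb-from-slot₁ f b false b' 2 _ rewrite ≡ᵇ-sym b' b with b ≡ᵇ b'
... | true  = refl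
... | false = refl
comb-from-slot₁ f b f'    b' 3 _ = refl
comb-from-slot₁ f b f' b' (suc (suc (suc (suc _)))) (s≤s (s≤s (s≤s (s≤s ()))))

comb-from-slot₂ : ∀ {Lst} f b f' b' r' → Slot Lst f b 2 → Slot Lst f' b' r' → CombStep f b 2 f' b' r'
comb-from-slot₂ true  b f'    b' 0 _ _ with b ≡ᵇ b' | 0 ≡ᵇ b'
... | true  | true  = refl
... | true  | false = refl
... | false | _     = refl
comb-from-slot₂ false b f'    b' 0 _ _ with b ≡ᵇ b' | suc b ≡ᵇ b'
... | true  | true  = refl
... | true  | false = refl
... | false | _     = refl
comb-from-slot₂ true  b f'    b' 1 _ _ with b ≡ᵇ b'
... | true  = refl
... | false = refl
comb-from-slot₂ false b f'    b' 1 _ _ with b ≡ᵇ b'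
... | true  = refl
... | false = refl
comb-from-slot₂ true  b true  b' 2 _ _ with b ≡ᵇ b'
... | true  = refl
... | false = refl
comb-from-slot₂ true  b false b' 2 _ _ with b ≡ᵇ b' | b' ≡ᵇ zero
... | true  | true  = refl
... | true  | false = refl
... | false | _     = refl
comb-from-slot₂ false b true  b' 2 _ _ with b ≡ᵇ b' | b ≡ᵇ zero
... | true  | true  = refl
... | true  | false = refl
... | false | _     = refl
comb-from-slot₂ false b false b' 2 _ _ with b ≡ᵇ b'
... | true  = refl
... | false = refl
comb-from-slot₂ true  b f     b' 3 s s' with Slot.no-q s' refl
comb-from-slot₂ true  b .false b' 3 s s' | refl = sym (≡ᵇ-false (λ p → last≢with-q s s' (sym p)))
comb-from-slot₂ false b f'    b' 3 _ _ rewrite ≡ᵇ-sym b' b with b ≡ᵇ b'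
... | true  = refl
... | false = refl
comb-from-slot₂ f b f' b' (suc (suc (suc (suc _)))) _ s' with Slot.r<4 s'
... | s≤s (s≤s (s≤s (s≤s ())))

comb-from-slot₃ : ∀ {Lst} f b f' b' r' → Slot Lst f b 3 → Slot Lst f' b' r' → CombStep f b 3 f' b' r'
comb-from-slot₃ f b f'     b' 0 _ _ with b' ≡ᵇ suc b
... | true  = refl
... | false = refl
comb-from-slot₃ f b f'     b' 1 _ _ = refl
comb-from-slot₃ f b true   b' 2 s s' with Slot.no-q s refl
comb-from-slot₃ .false b true b' 2 s s' | refl = sym (trans (∨-identityʳ _) (≡ᵇ-false (λ p → last≢with-q s' s (sym p))))
comb-from-slot₃ f b false  b' 2 _ _ rewrite ≡ᵇ-sym b' b with b ≡ᵇ b'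
... | true  = refl
... | false = refl
comb-from-slot₃ f b f'     b' 3 _ _ = refl
comb-from-slot₃ f b f' b' (suc (suc (suc (suc _)))) _ s' with Slot.r<4 s'
... | s≤s (s≤s (s≤s (s≤s ())))

comb-on-path : ∀ {Lst} f b r f' b' r' → Slot Lst f b r → Slot Lst f' b' r' → CombStep f b r f' b' r'
comb-on-path f b 0 f' b' r' _ s' = comb-from-slot₀ f b f' b' r' (Slot.r<4 s')
comb-on-path f b 1 f' b' r' _ s' = comb-from-slot₁ f b f' b' r' (Slot.r<4 s')
comb-on-path f b 2 f' b' r' s s' = comb-from-slot₂ f b f' b' r' s s'
comb-on-path f b 3 f' b' r' s s' = comb-from-slot₃ f b f' b' r' s s'
comb-on-path f b (suc (suc (suc (suc _)))) f' b' r' s _ with Slot.r<4 s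
... | s≤s (s≤s (s≤s (s≤s ())))

pathℕ : ℕ → ℕ → Bool
pathℕ a c = (a ≡ᵇ suc c) ∨ (c ≡ᵇ suc a)

pathℕ-next : ∀ a → pathℕ a (suc a) ≡ true
pathℕ-next a rewrite ≡ᵇ-refl a = ∨-zeroʳ _

pathℕ-prev : ∀ a → pathℕ (suc a) a ≡ true
pathℕ-prev a rewrite ≡ᵇ-refl a = refl

-- In P_K with K ≥ 4, two positions a < c are adjacent or have different
-- neighbourhoods (this fails for the endpoints of P₃).
path-distinguishes : ∀ K a c → 4 ≤ K → a < c → c < K → (∀ z → z < K → pathℕ a z ≡ pathℕ c z) → pathℕ a c ≡ false → ⊥
path-distinguishes K a c 4≤K a<c c<K same a≁c with c ℕ.≟ suc a | c ℕ.≟ suc (suc a)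
... | yes refl | _ = true≢false (trans (sym (pathℕ-next a)) a≁c)
... | no _ | no c≢a+2 =
  true≢false (trans (sym (pathℕ-next a)) (trans (same (suc a) (NP.≤-<-trans a<c c<K))
    (cong₂ _∨_ (≡ᵇ-false c≢a+2) (≡ᵇ-false (λ p → NP.<-irrefl (NP.suc-injective p) a<c)))))
... | no _ | yes refl with a
...   | zero   = true≢false (sym (same 3 4≤K))
...   | suc a' = true≢false (trans (sym (pathℕ-prev a')) (trans (same a' (NP.<-trans (NP.n<1+n a') (NP.<-trans a<c c<K)))
                   (cong₂ _∨_ (≡ᵇ-false (a'+3≢a'+1 a')) (≡ᵇ-false (a'≢a'+4 a')))))
  where
  a'+3≢a'+1 : ∀ a → suc (suc (suc a)) ≢ suc a
  a'+3≢a'+1 a p with NP.suc-injective p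
  ... | ()
  a'≢a'+4 : ∀ a → a ≢ suc (suc (suc (suc a)))
  a'≢a'+4 zero    ()
  a'≢a'+4 (suc a) p = a'≢a'+4 a (NP.suc-injective p)

path-realiser-separates : ∀ {N} K → 4 ≤ K → (ι : Fin K → Fin N) (B : Adj N) → (∀ v → B v v ≡ false) →
                          (∀ x y → B (ι x) (ι y) ≡ path K x y) → ∀ x y → toℕ x < toℕ y → ι x ≢ ι y
path-realiser-separates K 4≤K ι B loopless realises x y x<y e =
  path-distinguishes K (toℕ x) (toℕ y) 4≤K x<y (FP.toℕ<n y) same x≁y
  where
  path-at : ∀ w z (z<K : z < K) → B (ι w) (ι (F.fromℕ< z<K)) ≡ pathℕ (toℕ w) z
  path-at w z z<K = trans (realises w (F.fromℕ< z<K)) (cong (pathℕ (toℕ w)) (FP.toℕ-fromℕ< z<K))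
  same : ∀ z → z < K → pathℕ (toℕ x) z ≡ pathℕ (toℕ y) z
  same z z<K = trans (sym (path-at x z z<K)) (trans (cong (λ w → B w (ι (F.fromℕ< z<K))) e) (path-at y z z<K))
  x≁y : pathℕ (toℕ x) (toℕ y) ≡ false
  x≁y = trans (sym (realises x y)) (trans (cong (B (ι x)) (sym e)) (loopless (ι x)))

path-realiser-injective : ∀ {N} K → 4 ≤ K → (ι : Fin K → Fin N) (B : Adj N) → (∀ v → B v v ≡ false) →
                          (∀ x y → B (ι x) (ι y) ≡ path K x y) → Injective _≡_ _≡_ ι
path-realiser-injective K 4≤K ι B loopless realises {x} {y} ιx≡ιy with NP.<-cmp (toℕ x) (toℕ y)
... | tri≈ _ x≡y _ = FP.toℕ-injective x≡y
... | tri< x<y _ _ = ⊥-elim (path-realiser-separates K 4≤K ι B loopless realises x y x<y ιx≡ιy)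
... | tri> _ _ y<x = ⊥-elim (path-realiser-separates K 4≤K ι B loopless realises y x y<x (sym ιx≡ιy))

gadget≤ : ∀ b L r → b * 4 + r < L * 4 + 3 → b ≤ L
gadget≤ zero    L       r _ = z≤n
gadget≤ (suc b) zero    r (s≤s (s≤s (s≤s ())))
gadget≤ (suc b) (suc L) r (s≤s (s≤s (s≤s (s≤s h)))) = s≤s (gadget≤ b L r h)

gadget≢ : ∀ b L → b * 4 + 3 < L * 4 + 3 → b ≢ L
gadget≢ b L h refl = NP.<-irrefl refl h

-- Reading off the path in the comb of a graph with n = suc (suc (suc n₃))
-- ≥ 3: gadgets 0, …, Lst use the blocks 1, …, n - 1.
module CombPath (n₃ : ℕ) {N : ℕ} (e : Coord (suc (suc (suc n₃))) → Fin N) (e-eq : ∀ u v → (e u == e v) ≡ eqC u v) where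
  open Models (suc n₃)
  open Agreement e e-eq
  open Sequences (suc n₃) e e-eq using (ReachesComb)

  Lst : ℕ
  Lst = suc n₃

  K : ℕ
  K = Lst * 4 + 3

  4n-5≡K : 4 * n ∸ 5 ≡ K
  4n-5≡K = trans (cong (_∸ 5) (NP.*-comm 4 n)) (cong (4 +_) (NP.+-comm 3 (n₃ * 4)))

  -- from ℕ-coordinates to coordinates (values ≥ n do not occur)
  clamp : ℕ → Fin n
  clamp x with x NP.<? n
  ... | yes x<n = F.fromℕ< x<n
  ... | no _    = zero

  toℕ-clamp : ∀ x → x < n → toℕ (clamp x) ≡ x
  toℕ-clamp x x<n with x NP.<? n
  ... | yes p   = FP.toℕ-fromℕ< p
  ... | no  x≮n = ⊥-elim (x≮n x<n)

  toCoord : Pt → Coord n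
  toCoord (xD i k) = xv (clamp i) (clamp k)
  toCoord (qD l)   = qv (clamp l)

  InRange : Pt → Set
  InRange (xD i k) = (i < n) × (k < n)
  InRange (qD l)   = l < n

  toCoord-comb : ∀ d d' → InRange d → InRange d' → comb (toCoord d) (toCoord d') ≡ combℕ d d'
  toCoord-comb (xD i k) (xD j k') (i<n , k<n) (j<n , k'<n)
    rewrite eqF-toℕ (clamp i) (clamp j) | eqF-toℕ (clamp k) (clamp k') | eqF-toℕ (clamp k) zero | eqF-toℕ (clamp k') zero
          | toℕ-clamp i i<n | toℕ-clamp j j<n | toℕ-clamp k k<n | toℕ-clamp k' k'<n = refl
  toCoord-comb (xD i k) (qD l) (_ , k<n) l<n
    rewrite eqF-toℕ (clamp k) (clamp l) | eqF-toℕ (clamp k) zero | toℕ-clamp k k<n | toℕ-clamp l l<n = refl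
  toCoord-comb (qD l) (xD i k) l<n (_ , k<n)
    rewrite eqF-toℕ (clamp k) (clamp l) | eqF-toℕ (clamp k) zero | toℕ-clamp k k<n | toℕ-clamp l l<n = refl
  toCoord-comb (qD l) (qD l') _ _ = refl

  onComb-q : ∀ (l : Fin n) → 2 ≤ toℕ l → onComb (qv l) ≡ true
  onComb-q (suc (suc l)) _ = refl
  onComb-q zero          ()
  onComb-q (suc zero)    (s≤s ())

  block-on-comb : ∀ b k → b ≤ Lst → onComb (xv (clamp (suc b)) k) ≡ true
  block-on-comb b k b≤Lst rewrite eqF-toℕ (clamp (suc b)) zero | toℕ-clamp (suc b) (s≤s (s≤s b≤Lst)) = refl

  not-last : ∀ {b} → b ≤ Lst → false ≡ (b ≡ᵇ Lst) → suc (suc b) < n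
  not-last {b} b≤Lst f≡ = s≤s (s≤s (NP.≤∧≢⇒< b≤Lst (λ q → true≢false (trans (sym (trans (cong (_≡ᵇ Lst) q) (≡ᵇ-refl Lst))) (sym f≡)))))

  slot-on-comb : ∀ f b r → b ≤ Lst → Slot Lst f b r → InRange (pathVertex b r f) × (onComb (toCoord (pathVertex b r f)) ≡ true)
  slot-on-comb f     b 0 b≤Lst _ = (s≤s (s≤s b≤Lst) , s≤s (s≤s b≤Lst)) , block-on-comb b (clamp (suc b)) b≤Lst
  slot-on-comb f     b 1 b≤Lst _ = (s≤s (s≤s b≤Lst) , s≤s z≤n) , block-on-comb b (clamp 0) b≤Lst
  slot-on-comb true  b 2 b≤Lst _ = (s≤s (s≤s b≤Lst) , s≤s (s≤s z≤n)) , block-on-comb b (clamp 1) b≤Lst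
  slot-on-comb false b 2 b≤Lst s = (s≤s (s≤s b≤Lst) , not-last b≤Lst (Slot.last≡ s)) , block-on-comb b (clamp (suc (suc b))) b≤Lst
  slot-on-comb f     b 3 b≤Lst s = b+2<n , onComb-q (clamp (suc (suc b))) (subst (2 ≤_) (sym (toℕ-clamp _ b+2<n)) (s≤s (s≤s z≤n)))
    where b+2<n = not-last b≤Lst (trans (sym (Slot.no-q s refl)) (Slot.last≡ s))
  slot-on-comb f b (suc (suc (suc (suc _)))) _ s with Slot.r<4 s
  ... | s≤s (s≤s (s≤s (s≤s ())))

  gadget slot : ℕ → ℕ
  gadget p = p ℕ./ 4
  slot   p = p ℕ.% 4

  position : ∀ p → p ≡ gadget p * 4 + slot p
  position p = trans (DM.m≡m%n+[m/n]*n p 4) (NP.+-comm (slot p) (gadget p * 4))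

  vertexAt : ℕ → Pt
  vertexAt p = pathVertex (gadget p) (slot p) (gadget p ≡ᵇ Lst)

  slotOf : ∀ p → p < K → Slot Lst (gadget p ≡ᵇ Lst) (gadget p) (slot p)
  slotOf p p<K = record { r<4 = DM.m%n<n p 4 ; last≡ = refl ; no-q = λ r≡3 → ≡ᵇ-false (gadget≢ (gadget p) Lst (in-range r≡3)) }
    where
    in-range : slot p ≡ 3 → gadget p * 4 + 3 < K
    in-range r≡3 = subst (λ r → gadget p * 4 + r < K) r≡3 (subst (_< K) (position p) p<K)

  gadget≤Lst : ∀ p → p < K → gadget p ≤ Lst
  gadget≤Lst p p<K = gadget≤ (gadget p) Lst (slot p) (subst (_< K) (position p) p<K)

  vertexAt-on-comb : ∀ (x : Fin K) → InRange (vertexAt (toℕ x)) × (onComb (toCoord (vertexAt (toℕ x))) ≡ true)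
  vertexAt-on-comb x = slot-on-comb _ _ _ (gadget≤Lst (toℕ x) (FP.toℕ<n x)) (slotOf (toℕ x) (FP.toℕ<n x))

  pathℕ-slots : ∀ p p' → p < K → p' < K → pathℕ p p' ≡ follows (slot p) (slot p') (gadget p) (gadget p') ∨ follows (slot p') (slot p) (gadget p') (gadget p)
  pathℕ-slots p p' p<K p'<K =
    trans (cong₂ pathℕ (position p) (position p'))
          (cong₂ _∨_ (follows-correct _ _ _ _ (Slot.r<4 (slotOf p p<K)) (Slot.r<4 (slotOf p' p'<K)))
                     (follows-correct _ _ _ _ (Slot.r<4 (slotOf p' p'<K)) (Slot.r<4 (slotOf p p<K))))

  comb⇒path-minor : (G : Adj N) → (∀ v → G v v ≡ false) → ReachesComb G → IsVertexMinor (path (4 * n ∸ 5)) G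
  comb⇒path-minor G loopless (B , G⇝B , agrees on-comb) =
    subst (λ k → IsVertexMinor (path k) G) (sym 4n-5≡K)
      (B , G⇝B , ι , path-realiser-injective K (s≤s (s≤s (s≤s (s≤s z≤n)))) ι B (lcseq-loopless G⇝B loopless) realises
         , mk↔ₛ′ (λ x → x) (λ x → x) (λ _ → refl) (λ _ → refl) , realises)
    where
    ι : Fin K → Fin N
    ι x = e (toCoord (vertexAt (toℕ x)))

    realises : ∀ x y → B (ι x) (ι y) ≡ path K x y
    realises x y =
      begin
        B (ι x) (ι y)
      ≡⟨ on-comb _ _ (proj₂ (vertexAt-on-comb x)) (proj₂ (vertexAt-on-comb y)) ⟩
        comb (toCoord (vertexAt (toℕ x))) (toCoord (vertexAt (toℕ y)))
      ≡⟨ toCoord-comb _ _ (proj₁ (vertexAt-on-comb x)) (proj₁ (vertexAt-on-comb y)) ⟩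
        combℕ (vertexAt (toℕ x)) (vertexAt (toℕ y))
      ≡⟨ comb-on-path _ _ _ _ _ _ (slotOf (toℕ x) (FP.toℕ<n x)) (slotOf (toℕ y) (FP.toℕ<n y)) ⟩
        follows (slot (toℕ x)) (slot (toℕ y)) (gadget (toℕ x)) (gadget (toℕ y)) ∨
        follows (slot (toℕ y)) (slot (toℕ x)) (gadget (toℕ y)) (gadget (toℕ x))
      ≡⟨ sym (pathℕ-slots (toℕ x) (toℕ y) (FP.toℕ<n x) (FP.toℕ<n y)) ⟩
        path K x y
      ∎
      where open ≡-Reasoning

inducedP3⇒minor : ∀ {N} (G : Adj N) → IsSimple G → InducedP3 G → IsVertexMinor (path 3) G
inducedP3⇒minor G (G-sym , loopless) P = G , lc-refl , ι , ι-inj , mk↔ₛ′ (λ x → x) (λ x → x) (λ _ → refl) (λ _ → refl) , realises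
  where
  open InducedP3 P
  adjacent-distinct : ∀ {u v} → G u v ≡ true → u ≢ v
  adjacent-distinct {u} uv refl = true≢false (trans (sym uv) (loopless u))
  ι : Fin 3 → Fin _
  ι zero             = a
  ι (suc zero)       = b
  ι (suc (suc zero)) = c
  ι-inj : Injective _≡_ _≡_ ι
  ι-inj {zero}             {zero}             _ = refl
  ι-inj {zero}             {suc zero}         p = ⊥-elim (adjacent-distinct ab p)
  ι-inj {zero}             {suc (suc zero)}   p = ⊥-elim (a≢c p)
  ι-inj {suc zero}         {zero}             p = ⊥-elim (adjacent-distinct ab (sym p))
  ι-inj {suc zero}         {suc zero}         _ = refl
  ι-inj {suc zero}         {suc (suc zero)}   p = ⊥-elim (adjacent-distinct bc p)
  ι-inj {suc (suc zero)}   {zero}             p = ⊥-elim (a≢c (sym p))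
  ι-inj {suc (suc zero)}   {suc zero}         p = ⊥-elim (adjacent-distinct bc (sym p))
  ι-inj {suc (suc zero)}   {suc (suc zero)}   _ = refl
  realises : ∀ x y → induced G ι x y ≡ path 3 x y
  realises zero             zero             = loopless a
  realises zero             (suc zero)       = ab
  realises zero             (suc (suc zero)) = ac
  realises (suc zero)       zero             = trans (G-sym b a) ab
  realises (suc zero)       (suc zero)       = loopless b
  realises (suc zero)       (suc (suc zero)) = bc
  realises (suc (suc zero)) zero             = trans (G-sym c a) ac
  realises (suc (suc zero)) (suc zero)       = trans (G-sym c b) bc
  realises (suc (suc zero)) (suc (suc zero)) = loopless c

third : ∀ {n₃} (a b : Fin (suc (suc (suc n₃)))) → Σ (Fin (suc (suc (suc n₃)))) λ c → c ≢ a × c ≢ b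
third a b with zero F.≟ a | zero F.≟ b | suc zero F.≟ a | suc zero F.≟ b
... | no 0≢a   | no 0≢b   | _        | _        = zero , 0≢a , 0≢b
... | yes _    | _        | no 1≢a   | no 1≢b   = suc zero , 1≢a , 1≢b
... | no _     | yes _    | no 1≢a   | no 1≢b   = suc zero , 1≢a , 1≢b
... | yes refl | _        | yes ()   | _
... | _        | yes refl | _        | yes ()
... | yes refl | no _     | no _     | yes refl = suc (suc zero) , (λ ()) , (λ ())
... | no _     | yes refl | yes refl | no _     = suc (suc zero) , (λ ()) , (λ ())

lemma4p7 : (n : ℕ) → 2 ≤ n →
    (G : Adj (n * n + n)) → IsSimple G →
    (X : Fin n → Fin n → Fin (n * n + n)) → (Q : Fin n → Fin (n * n + n)) →
    Bijective _≡_ _≡_ (enumAll X Q) →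
    (∀ i a b → a ≢ b → G (X i a) (X i b) ≡ true) →
    Iso (induced G (enumXs X)) (nKn n) →
    (∀ i → Iso (induced G (enumXQ X Q i)) (KnPlusNeqCoKn n)) →
    IsVertexMinor (path (4 * n ∸ 5)) G
lemma4p7 zero                 ()
lemma4p7 (suc zero)           (s≤s ())
lemma4p7 (suc (suc zero))     _ G simple X Q bij clique isoX isoQ =
  inducedP3⇒minor G simple (Hypotheses.Assume.inducedP3 1 G simple X Q bij clique isoX isoQ (suc zero) (λ ()))
lemma4p7 (suc (suc (suc n₃))) _ G simple X Q bij clique isoX isoQ =
  CombPath.comb⇒path-minor n₃ e e-eq G (proj₂ simple) (Sequences.normal⇒comb (suc n₃) e e-eq G isTypeB agree)
  where
  open Hypotheses.Assume (suc (suc n₃)) G simple X Q bij clique isoX isoQ using (module WithThird)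
  open NormalForm (WithThird.normalForm third)
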